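{- Let $M$ be a loopless matroid with lattice of flats $\mathcal{L}$. Then \[ H_M(q) = \overline{\chi}_M(q) + \sum_{F \in \widehat\mathcal{L}} \overline{\chi}_{M/F}(q)\, H_{M|F}(q). \]
   Context: For a matroid $N$: $\overline{\chi}_N=\chi_N/(q-1)$ is the reduced characteristic polynomial; $[n]_q=1+q+\dots+q^{n-1}$; $\mathcal{N}(N)$ is the set of flags of flats strictly containing $\operatorname{cl}(\emptyset)$ (including the empty flag); for a flag $\mathcal{F}$ and $F\in\mathcal{F}$, $z_\mathcal{F}(F)=\max(\mathcal{F}_{<F})$ (or $\operatorname{cl}(\emptyset)$, rank $0$, if none). Define $H_N(q)=\sum_{\mathcal{F}\in\mathcal{N}(N)}\prod_{F\in\mathcal{F}}([\operatorname{rk}F-\operatorname{rk}z_\mathcal{F}(F)]_q-1)$. Here $\widehat{\mathcal{L}}=\mathcal{L}\setminus\{\operatorname{cl}(\emptyset),E\}$ with $E$ the ground set of $M$. -}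

module Defs where

open import Data.Bool using (Bool; true; false; _∧_)
open import Data.Nat as ℕ using (ℕ; zero; suc; _∸_; _≡ᵇ_)
open import Data.Integer as ℤ using (ℤ; +_; -_; _+_; _*_; _-_; _^_)
open import Data.Fin using (Fin)
open import Data.Fin.Subset
  using (Subset; _∈_; _⊆_; _⊂_; _∪_; _∩_; _─_; ⁅_⁆; ∣_∣; ⊥)
open import Data.Fin.Subset.Properties using (_⊆?_; _⊂?_)
open import Data.Vec as Vec using (Vec; []; _∷_; tabulate; lookup)
open import Data.Vec.Properties using (≡-dec)
import Data.Bool.Properties as BoolP
open import Data.List as List using (List; []; _∷_; map; concatMap; filter; applyUpTo; foldr)
open import Data.Product using (_×_)
open import Data.Unit using (⊤; tt)
open import Relation.Nullary using (Dec; yes)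
open import Relation.Nullary.Decidable using (_×-dec_)
open import Relation.Binary.PropositionalEquality using (_≡_)

-- A matroid is given on a ground set  E ⊆ Fin n  by its rank function
-- rk : Subset n → ℕ  (only its values on subsets of E matter).
-- Polynomials with integer coefficients are compared by evaluation at
-- every integer q (equivalent to equality of polynomials over ℤ).

record IsMatroid {n : ℕ} (E : Subset n) (rk : Subset n → ℕ) : Set where
  field
    rk-bound  : ∀ A → A ⊆ E → rk A ℕ.≤ ∣ A ∣
    rk-mono   : ∀ A B → A ⊆ B → B ⊆ E → rk A ℕ.≤ rk B
    rk-submod : ∀ A B → A ⊆ E → B ⊆ E →
                rk (A ∪ B) ℕ.+ rk (A ∩ B) ℕ.≤ rk A ℕ.+ rk B

Loopless : {n : ℕ} (E : Subset n) (rk : Subset n → ℕ) → Set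
Loopless E rk = ∀ x → x ∈ E → rk ⁅ x ⁆ ≡ 1

allSubsets : (n : ℕ) → List (Subset n)
allSubsets zero = [] ∷ []
allSubsets (suc n) = map (true ∷_) (allSubsets n) List.++ map (false ∷_) (allSubsets n)

subsetsOf : {n : ℕ} → Subset n → List (Subset n)
subsetsOf {n} E = filter (_⊆? E) (allSubsets n)

cl : {n : ℕ} (E : Subset n) (rk : Subset n → ℕ) → Subset n → Subset n
cl E rk A = tabulate (λ i → lookup E i ∧ (rk (A ∪ ⁅ i ⁆) ≡ᵇ rk A))

IsFlat : {n : ℕ} (E : Subset n) (rk : Subset n → ℕ) → Subset n → Set
IsFlat E rk A = A ⊆ E × cl E rk A ≡ A

isFlat? : {n : ℕ} (E : Subset n) (rk : Subset n → ℕ) (A : Subset n) → Dec (IsFlat E rk A)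
isFlat? E rk A = (A ⊆? E) ×-dec ≡-dec BoolP._≟_ (cl E rk A) A

flats : {n : ℕ} (E : Subset n) (rk : Subset n → ℕ) → List (Subset n)
flats {n} E rk = filter (isFlat? E rk) (allSubsets n)

Lhat : {n : ℕ} (E : Subset n) (rk : Subset n → ℕ) → List (Subset n)
Lhat E rk = filter (λ F → cl E rk ⊥ ⊂? F) (filter (λ F → F ⊂? E) (flats E rk))

-- Flags.  A flag F₁ ⊊ F₂ ⊊ … ⊊ F_k of flats strictly containing cl(∅)
-- is represented by the increasing list [F₁ , … , F_k].
-- FlagAbove Z L : L is a strictly increasing list of flats, all ⊋ Z.

FlagAbove : {n : ℕ} (E : Subset n) (rk : Subset n → ℕ) → Subset n → List (Subset n) → Set
FlagAbove E rk Z [] = ⊤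
FlagAbove E rk Z (F ∷ Fs) = IsFlat E rk F × Z ⊂ F × FlagAbove E rk F Fs

flagAbove? : {n : ℕ} (E : Subset n) (rk : Subset n → ℕ) (Z : Subset n) (L : List (Subset n)) →
             Dec (FlagAbove E rk Z L)
flagAbove? E rk Z [] = yes tt
flagAbove? E rk Z (F ∷ Fs) = isFlat? E rk F ×-dec ((Z ⊂? F) ×-dec flagAbove? E rk F Fs)

listsOfLength : {n : ℕ} → ℕ → List (List (Subset n))
listsOfLength zero = [] ∷ []
listsOfLength {n} (suc k) =
  concatMap (λ A → map (A ∷_) (listsOfLength k)) (allSubsets n)

-- all lists of subsets of length ≤ n (a strict chain of subsets of Fin n
-- above cl(∅) has length ≤ n, so this contains every flag)
listsUpTo : (n : ℕ) → List (List (Subset n))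
listsUpTo n = concatMap (λ k → listsOfLength k) (applyUpTo (λ k → k) (suc n))

flags : {n : ℕ} (E : Subset n) (rk : Subset n → ℕ) → List (List (Subset n))
flags {n} E rk = filter (flagAbove? E rk (cl E rk ⊥)) (listsUpTo n)

sumℤ : List ℤ → ℤ
sumℤ = foldr _+_ (+ 0)

qint : ℕ → ℤ → ℤ
qint m q = sumℤ (applyUpTo (λ i → q ^ i) m)

flagWeight : {n : ℕ} (rk : Subset n → ℕ) → Subset n → List (Subset n) → ℤ → ℤ
flagWeight rk Z [] q = + 1
flagWeight rk Z (F ∷ Fs) q = (qint (rk F ∸ rk Z) q - + 1) * flagWeight rk F Fs q

H : {n : ℕ} (E : Subset n) (rk : Subset n → ℕ) → ℤ → ℤ
H E rk q = sumℤ (map (λ L → flagWeight rk (cl E rk ⊥) L q) (flags E rk))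

-- coefficient lists (lowest degree first)
evalPoly : List ℤ → ℤ → ℤ
evalPoly [] q = + 0
evalPoly (a ∷ as) q = a + q * evalPoly as q

-- quotient of polynomial division by (q - 1):
-- for p = a₀ + a₁q + … + a_d q^d the quotient has coefficients
-- b_j = a_{j+1} + … + a_d  (j = 0 … d-1); the remainder p(1) is dropped.
suffixSums : List ℤ → List ℤ
suffixSums [] = []
suffixSums (a ∷ as) = (a + sumℤ as) ∷ suffixSums as

divByQminus1 : List ℤ → List ℤ
divByQminus1 [] = []
divByQminus1 (a ∷ as) = suffixSums as

sign : ℕ → ℤ
sign m = (- + 1) ^ m

-- characteristic polynomial  χ_N(q) = Σ_{A ⊆ E} (-1)^|A| q^(rk E - rk A),
-- as a coefficient list of length rk E + 1
charPolyCoeffs : {n : ℕ} (E : Subset n) (rk : Subset n → ℕ) → List ℤ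
charPolyCoeffs E rk =
  applyUpTo (λ k → sumℤ (map (λ A → sign ∣ A ∣)
                               (filter (λ A → (rk E ∸ rk A) ℕ.≟ k) (subsetsOf E))))
            (suc (rk E))

charPoly : {n : ℕ} (E : Subset n) (rk : Subset n → ℕ) → ℤ → ℤ
charPoly E rk = evalPoly (charPolyCoeffs E rk)

redCharPoly : {n : ℕ} (E : Subset n) (rk : Subset n → ℕ) → ℤ → ℤ
redCharPoly E rk = evalPoly (divByQminus1 (charPolyCoeffs E rk))

-- M / F : ground set E ─ F, rank A ↦ rk (A ∪ F) - rk F
contractRk : {n : ℕ} (rk : Subset n → ℕ) (F : Subset n) → Subset n → ℕ
contractRk rk F A = rk (A ∪ F) ∸ rk F

-- M | F : ground set F, same rank function (restricted to subsets of F)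

-- Let T W Z (flagSum W Z below) be the weighted sum over the flags of flats of M|W lying strictly
-- above Z, so that H_{M|W} = T W cl(∅).  Removing the first flat A of a flag gives
--   T W Z = 1 + Σ_{Z ⊊ A} ([rk A - rk Z]_q - 1) · T W A.
-- Expanding χ̄_{M/F} = Σ_{A ⊆ E∖F} (-1)^|A| [rk E - rk (A ∪ F)]_q and applying Möbius inversion in
-- the lattice of flats gives Σ_{Z ⊆ F ⊊ E} χ̄_{M/F} = [rk E - rk Z]_q.  With these two identities,
-- downward induction on the flat Z ⊊ E proves
--   T E Z = Σ_{Z ⊆ F ⊊ E} χ̄_{M/F} · T F Z,
-- and at Z = cl(∅) = ∅ the term F = ∅ is χ̄_M while the others are χ̄_{M/F} · H_{M|F}.

module Submission where

open import Defs
open import Data.Bool using (true; false; T; if_then_else_)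
import Data.Bool.Properties as Boolₚ
open import Data.Empty using (⊥-elim)
open import Data.Fin using (Fin)
import Data.Fin.Properties as Finₚ
open import Data.Fin.Subset
  using (Subset; inside; outside; _∈_; _∉_; _⊆_; _⊂_; _∪_; _∩_; _─_; ⁅_⁆; ∣_∣; ⊥; Nonempty)
  renaming (_-_ to _-ₛ_)
open import Data.Fin.Subset.Properties
  using (_⊆?_; _⊂?_; _∈?_; ⊆-refl; ⊆-trans; ⊆-antisym; ⊂-irref; ⊂-⊆-trans; ⊆-⊂-trans; ⊥⊆; ∉⊥; ∣⊥∣≡0;
         ∣p∣≤n; p⊂q⇒∣p∣<∣q∣; p⊆p∪q; q⊆p∪q; x∈p∪q⁻; p∩q⊆p; x∈p∩q⁺; ∪-identityˡ; ∪-identityʳ; x∈⁅x⁆; x∈⁅y⁆⇒x≡y;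
         p─⊥≡p; p─q⊆p; x∈p∧x∉q⇒x∈p─q; x∈p∧x≢y⇒x∈p-y; x∈p⇒p-x⊂p; nonempty?)
open import Data.Fin.Subset.Induction using (⊂-wellFounded; ⊃-wellFounded)
open import Data.Integer as ℤ using (ℤ; -_; _+_; _*_; _-_; 0ℤ; 1ℤ)
import Data.Integer.Properties as ℤₚ
open import Data.Integer.Tactic.RingSolver using (solve-∀)
open import Data.List using (List; []; _∷_; map; filter; concat; concatMap; applyUpTo; upTo; _++_)
open import Data.Nat as ℕ using (ℕ; zero; suc; _∸_)
import Data.Nat.Properties as ℕₚ
open import Data.Product using (_×_; _,_; proj₁; proj₂)
open import Data.Sum using (inj₁; inj₂)
open import Data.Vec using ([]; _∷_; here; there; lookup)
open import Data.Vec.Properties using (≡-dec; []=⇒lookup; lookup⇒[]=; lookup∘tabulate)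
open import Function using (_∘_)
open import Function.Bundles using (Equivalence; _⇔_; mk⇔)
open import Induction.WellFounded using (module All)
open import Level using (0ℓ)
open import Relation.Binary.PropositionalEquality
open import Relation.Nullary using (Dec; yes; no; ¬_; does; contradiction)
open import Relation.Nullary.Decidable using (_×-dec_; ¬?)
open import Relation.Unary using (Pred; Decidable)

-- Iverson brackets and finite sums

when : {P : Set} → Dec P → ℤ → ℤ
when d x = if does d then x else 0ℤ

when-yes : {P : Set} (d : Dec P) → P → ∀ x → when d x ≡ x
when-yes (yes _) p x = refl
when-yes (no ¬p) p x = contradiction p ¬p

when-no : {P : Set} (d : Dec P) → ¬ P → ∀ x → when d x ≡ 0ℤ
when-no (yes p) ¬p x = contradiction p ¬p
when-no (no _)  ¬p x = refl

when-cong : {P : Set} (d : Dec P) {x y : ℤ} → (P → x ≡ y) → when d x ≡ when d y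
when-cong (yes p) x≡y = x≡y p
when-cong (no _)  x≡y = refl

when-⇔ : {P Q : Set} (d : Dec P) (e : Dec Q) → (P → Q) → (Q → P) → ∀ x → when d x ≡ when e x
when-⇔ (yes p) e P⇒Q Q⇒P x = sym (when-yes e (P⇒Q p) x)
when-⇔ (no ¬p) e P⇒Q Q⇒P x = sym (when-no e (¬p ∘ Q⇒P) x)

when-comm : {P Q : Set} (d : Dec P) (e : Dec Q) → ∀ x → when d (when e x) ≡ when e (when d x)
when-comm (yes _) (yes _) x = refl
when-comm (yes _) (no _)  x = refl
when-comm (no _)  (yes _) x = refl
when-comm (no _)  (no _)  x = refl

when-zero : {P : Set} (d : Dec P) → when d 0ℤ ≡ 0ℤ
when-zero (yes _) = refl
when-zero (no _)  = refl

when-+ : {P : Set} (d : Dec P) → ∀ x y → when d (x + y) ≡ when d x + when d y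
when-+ (yes _) x y = refl
when-+ (no _)  x y = refl

when-- : {P : Set} (d : Dec P) → ∀ x y → when d (x - y) ≡ when d x - when d y
when-- (yes _) x y = refl
when-- (no _)  x y = refl

when-neg : {P : Set} (d : Dec P) → ∀ x → when d (- x) ≡ - when d x
when-neg (yes _) x = refl
when-neg (no _)  x = refl

when-*ʳ : {P : Set} (d : Dec P) → ∀ x y → when d x * y ≡ when d (x * y)
when-*ʳ (yes _) x y = refl
when-*ʳ (no _)  x y = refl

when-*ˡ : {P : Set} (d : Dec P) → ∀ x y → x * when d y ≡ when d (x * y)
when-*ˡ (yes _) x y = refl
when-*ˡ (no _)  x y = ℤₚ.*-zeroʳ x

when-× : {P Q : Set} (d : Dec P) (e : Dec Q) → ∀ x → when (d ×-dec e) x ≡ when d (when e x)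
when-× (yes _) e x = refl
when-× (no _)  e x = refl

when-*-when : {P Q : Set} (d : Dec P) (e : Dec Q) → ∀ x y → when d (x * when e y) ≡ when (d ×-dec e) (x * y)
when-*-when (yes _) e x y = when-*ˡ e x y
when-*-when (no _)  e x y = refl

infix 4 _≟ₛ_
_≟ₛ_ : {n : ℕ} (A B : Subset n) → Dec (A ≡ B)
_≟ₛ_ = ≡-dec Boolₚ._≟_

when-≟-sym : {n : ℕ} (A B : Subset n) → ∀ x → when (A ≟ₛ B) x ≡ when (B ≟ₛ A) x
when-≟-sym A B = when-⇔ (A ≟ₛ B) (B ≟ₛ A) sym sym

Σₛ : {n : ℕ} → (Subset n → ℤ) → ℤ
Σₛ {zero}  f = f []
Σₛ {suc n} f = Σₛ (f ∘ (true ∷_)) + Σₛ (f ∘ (false ∷_))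

Σₛ-cong : {n : ℕ} {f g : Subset n → ℤ} → (∀ A → f A ≡ g A) → Σₛ f ≡ Σₛ g
Σₛ-cong {zero}  f≗g = f≗g []
Σₛ-cong {suc n} f≗g = cong₂ _+_ (Σₛ-cong (f≗g ∘ (true ∷_))) (Σₛ-cong (f≗g ∘ (false ∷_)))

Σₛ-zero : {n : ℕ} → Σₛ {n} (λ _ → 0ℤ) ≡ 0ℤ
Σₛ-zero {zero}  = refl
Σₛ-zero {suc n} = cong₂ _+_ (Σₛ-zero {n}) (Σₛ-zero {n})

Σₛ-+ : {n : ℕ} (f g : Subset n → ℤ) → Σₛ (λ A → f A + g A) ≡ Σₛ f + Σₛ g
Σₛ-+ {zero}  f g = refl
Σₛ-+ {suc n} f g = begin
  Σₛ (λ A → f (true ∷ A) + g (true ∷ A)) + Σₛ (λ A → f (false ∷ A) + g (false ∷ A))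
    ≡⟨ cong₂ _+_ (Σₛ-+ (f ∘ (true ∷_)) (g ∘ (true ∷_))) (Σₛ-+ (f ∘ (false ∷_)) (g ∘ (false ∷_))) ⟩
  (Σₛ (f ∘ (true ∷_)) + Σₛ (g ∘ (true ∷_))) + (Σₛ (f ∘ (false ∷_)) + Σₛ (g ∘ (false ∷_)))
    ≡⟨ interchange (Σₛ (f ∘ (true ∷_))) (Σₛ (g ∘ (true ∷_))) (Σₛ (f ∘ (false ∷_))) (Σₛ (g ∘ (false ∷_))) ⟩
  (Σₛ (f ∘ (true ∷_)) + Σₛ (f ∘ (false ∷_))) + (Σₛ (g ∘ (true ∷_)) + Σₛ (g ∘ (false ∷_))) ∎
  where
  open ≡-Reasoning
  interchange : ∀ a b c d → (a + b) + (c + d) ≡ (a + c) + (b + d)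
  interchange = solve-∀

Σₛ-*ˡ : {n : ℕ} (c : ℤ) (f : Subset n → ℤ) → Σₛ (λ A → c * f A) ≡ c * Σₛ f
Σₛ-*ˡ {zero}  c f = refl
Σₛ-*ˡ {suc n} c f = trans (cong₂ _+_ (Σₛ-*ˡ {n} c _) (Σₛ-*ˡ {n} c _)) (sym (ℤₚ.*-distribˡ-+ c _ _))

Σₛ-neg : {n : ℕ} (f : Subset n → ℤ) → Σₛ (λ A → - f A) ≡ - Σₛ f
Σₛ-neg {n} f = begin
  Σₛ (λ A → - f A)        ≡⟨ Σₛ-cong {n} (λ A → sym (ℤₚ.-1*i≡-i (f A))) ⟩
  Σₛ (λ A → - 1ℤ * f A)   ≡⟨ Σₛ-*ˡ {n} (- 1ℤ) f ⟩
  - 1ℤ * Σₛ f             ≡⟨ ℤₚ.-1*i≡-i _ ⟩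
  - Σₛ f                  ∎
  where
  open ≡-Reasoning

Σₛ-- : {n : ℕ} (f g : Subset n → ℤ) → Σₛ (λ A → f A - g A) ≡ Σₛ f - Σₛ g
Σₛ-- {n} f g = trans (Σₛ-+ {n} f (λ A → - g A)) (cong (_+_ (Σₛ f)) (Σₛ-neg {n} g))

Σₛ-when : {n : ℕ} {P : Set} (d : Dec P) (f : Subset n → ℤ) → Σₛ (λ A → when d (f A)) ≡ when d (Σₛ f)
Σₛ-when (yes _) f = refl
Σₛ-when {n} (no _) f = Σₛ-zero {n}

Σₛ-swap : {m n : ℕ} (f : Subset m → Subset n → ℤ) →
          Σₛ (λ A → Σₛ (λ B → f A B)) ≡ Σₛ (λ B → Σₛ (λ A → f A B))
Σₛ-swap {zero}  f = refl
Σₛ-swap {suc m} {n} f = begin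
  Σₛ (λ A → Σₛ (f (true ∷ A))) + Σₛ (λ A → Σₛ (f (false ∷ A)))
    ≡⟨ cong₂ _+_ (Σₛ-swap (f ∘ (true ∷_))) (Σₛ-swap (f ∘ (false ∷_))) ⟩
  Σₛ (λ B → Σₛ (λ A → f (true ∷ A) B)) + Σₛ (λ B → Σₛ (λ A → f (false ∷ A) B))
    ≡⟨ Σₛ-+ {n} _ _ ⟨
  Σₛ (λ B → Σₛ (λ A → f (true ∷ A) B) + Σₛ (λ A → f (false ∷ A) B)) ∎
  where
  open ≡-Reasoning

Σₛ-point : {n : ℕ} (B : Subset n) (f : Subset n → ℤ) → Σₛ (λ A → when (A ≟ₛ B) (f A)) ≡ f B
Σₛ-point [] f = refl
Σₛ-point {suc n} (true ∷ B) f = begin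
  Σₛ (λ A → when (A ≟ₛ B) (f (true ∷ A))) + Σₛ {n} (λ _ → 0ℤ)
    ≡⟨ cong₂ _+_ (Σₛ-point B (f ∘ (true ∷_))) (Σₛ-zero {n}) ⟩
  f (true ∷ B) + 0ℤ
    ≡⟨ ℤₚ.+-identityʳ _ ⟩
  f (true ∷ B) ∎
  where
  open ≡-Reasoning
Σₛ-point {suc n} (false ∷ B) f = begin
  Σₛ {n} (λ _ → 0ℤ) + Σₛ (λ A → when (A ≟ₛ B) (f (false ∷ A)))
    ≡⟨ cong₂ _+_ (Σₛ-zero {n}) (Σₛ-point B (f ∘ (false ∷_))) ⟩
  0ℤ + f (false ∷ B)
    ≡⟨ ℤₚ.+-identityˡ _ ⟩
  f (false ∷ B) ∎
  where
  open ≡-Reasoning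

Σₛ-fibres : {n : ℕ} (c : Subset n → Subset n) (f g : Subset n → ℤ) →
            Σₛ (λ A → f A * g (c A)) ≡ Σₛ (λ H → g H * Σₛ (λ A → when (c A ≟ₛ H) (f A)))
Σₛ-fibres {n} c f g = begin
  Σₛ (λ A → f A * g (c A))
    ≡⟨ Σₛ-cong {n} (λ A → trans (ℤₚ.*-comm (f A) _) (sym (Σₛ-point (c A) (λ H → g H * f A)))) ⟩
  Σₛ (λ A → Σₛ (λ H → when (H ≟ₛ c A) (g H * f A)))
    ≡⟨ Σₛ-swap {n} {n} _ ⟩
  Σₛ (λ H → Σₛ (λ A → when (H ≟ₛ c A) (g H * f A)))
    ≡⟨ Σₛ-cong {n} (λ H → Σₛ-cong {n} (λ A → trans (when-≟-sym H (c A) _) (sym (when-*ˡ (c A ≟ₛ H) (g H) (f A))))) ⟩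
  Σₛ (λ H → Σₛ (λ A → g H * when (c A ≟ₛ H) (f A)))
    ≡⟨ Σₛ-cong {n} (λ H → Σₛ-*ˡ {n} (g H) _) ⟩
  Σₛ (λ H → g H * Σₛ (λ A → when (c A ≟ₛ H) (f A))) ∎
  where open ≡-Reasoning

Σₛ-split : {n : ℕ} (C : Subset n) (f : Subset n → ℤ) → Σₛ f ≡ f C + Σₛ (λ A → when (¬? (A ≟ₛ C)) (f A))
Σₛ-split {n} C f = begin
  Σₛ f
    ≡⟨ Σₛ-cong {n} split ⟩
  Σₛ (λ A → when (A ≟ₛ C) (f A) + when (¬? (A ≟ₛ C)) (f A))
    ≡⟨ Σₛ-+ {n} _ _ ⟩
  Σₛ (λ A → when (A ≟ₛ C) (f A)) + Σₛ (λ A → when (¬? (A ≟ₛ C)) (f A))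
    ≡⟨ cong (_+ Σₛ (λ A → when (¬? (A ≟ₛ C)) (f A))) (Σₛ-point C f) ⟩
  f C + Σₛ (λ A → when (¬? (A ≟ₛ C)) (f A)) ∎
  where
  open ≡-Reasoning
  split : ∀ A → f A ≡ when (A ≟ₛ C) (f A) + when (¬? (A ≟ₛ C)) (f A)
  split A with A ≟ₛ C
  ... | yes _ = sym (ℤₚ.+-identityʳ (f A))
  ... | no  _ = sym (ℤₚ.+-identityˡ (f A))

sumMap : {A : Set} → (A → ℤ) → List A → ℤ
sumMap f xs = sumℤ (map f xs)

sumMap-cong : {A : Set} {f g : A → ℤ} → (∀ x → f x ≡ g x) → (xs : List A) → sumMap f xs ≡ sumMap g xs
sumMap-cong f≗g []       = refl
sumMap-cong f≗g (x ∷ xs) = cong₂ _+_ (f≗g x) (sumMap-cong f≗g xs)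

sumMap-++ : {A : Set} (f : A → ℤ) (xs ys : List A) → sumMap f (xs ++ ys) ≡ sumMap f xs + sumMap f ys
sumMap-++ f []       ys = sym (ℤₚ.+-identityˡ _)
sumMap-++ f (x ∷ xs) ys = trans (cong (f x +_) (sumMap-++ f xs ys)) (sym (ℤₚ.+-assoc (f x) _ _))

sumMap-map : {A B : Set} (f : B → ℤ) (g : A → B) (xs : List A) → sumMap f (map g xs) ≡ sumMap (f ∘ g) xs
sumMap-map f g []       = refl
sumMap-map f g (x ∷ xs) = cong (f (g x) +_) (sumMap-map f g xs)

sumMap-concatMap : {A B : Set} (f : B → ℤ) (g : A → List B) (xs : List A) →
                   sumMap f (concatMap g xs) ≡ sumMap (sumMap f ∘ g) xs
sumMap-concatMap f g []       = refl
sumMap-concatMap f g (x ∷ xs) =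
  trans (sumMap-++ f (g x) (concat (map g xs))) (cong (sumMap f (g x) +_) (sumMap-concatMap f g xs))

sumMap-filter : {A : Set} {P : Pred A _} (P? : Decidable P) (f : A → ℤ) (xs : List A) →
                sumMap f (filter P? xs) ≡ sumMap (λ x → when (P? x) (f x)) xs
sumMap-filter P? f [] = refl
sumMap-filter P? f (x ∷ xs) with does (P? x)
... | true  = cong (f x +_) (sumMap-filter P? f xs)
... | false = trans (sumMap-filter P? f xs) (sym (ℤₚ.+-identityˡ _))

sumMap-*ˡ : {A : Set} (c : ℤ) (f : A → ℤ) (xs : List A) → sumMap (λ x → c * f x) xs ≡ c * sumMap f xs
sumMap-*ˡ c f []       = sym (ℤₚ.*-zeroʳ c)
sumMap-*ˡ c f (x ∷ xs) = trans (cong (c * f x +_) (sumMap-*ˡ c f xs)) (sym (ℤₚ.*-distribˡ-+ c _ _))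

sumMap-when : {A P : Set} (d : Dec P) (f : A → ℤ) (xs : List A) → sumMap (λ x → when d (f x)) xs ≡ when d (sumMap f xs)
sumMap-when (yes _) f xs       = refl
sumMap-when (no _)  f []       = refl
sumMap-when (no ¬p) f (x ∷ xs) = trans (ℤₚ.+-identityˡ _) (sumMap-when (no ¬p) f xs)

sumMap-allSubsets : (n : ℕ) (f : Subset n → ℤ) → sumMap f (allSubsets n) ≡ Σₛ f
sumMap-allSubsets zero    f = ℤₚ.+-identityʳ _
sumMap-allSubsets (suc n) f = begin
  sumMap f (map (true ∷_) (allSubsets n) ++ map (false ∷_) (allSubsets n))
    ≡⟨ sumMap-++ f (map (true ∷_) (allSubsets n)) (map (false ∷_) (allSubsets n)) ⟩
  sumMap f (map (true ∷_) (allSubsets n)) + sumMap f (map (false ∷_) (allSubsets n))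
    ≡⟨ cong₂ _+_ (trans (sumMap-map f (true ∷_) (allSubsets n)) (sumMap-allSubsets n _))
                 (trans (sumMap-map f (false ∷_) (allSubsets n)) (sumMap-allSubsets n _)) ⟩
  Σₛ (f ∘ (true ∷_)) + Σₛ (f ∘ (false ∷_)) ∎
  where
  open ≡-Reasoning

Σ< : ℕ → (ℕ → ℤ) → ℤ
Σ< m f = sumℤ (applyUpTo f m)

sumMap-applyUpTo : (m : ℕ) (f : ℕ → ℤ) (g : ℕ → ℕ) → sumMap f (applyUpTo g m) ≡ Σ< m (f ∘ g)
sumMap-applyUpTo zero    f g = refl
sumMap-applyUpTo (suc m) f g = cong (f (g 0) +_) (sumMap-applyUpTo m f (g ∘ suc))

Σ<-cong : (m : ℕ) {f g : ℕ → ℤ} → (∀ k → f k ≡ g k) → Σ< m f ≡ Σ< m g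
Σ<-cong zero    f≗g = refl
Σ<-cong (suc m) f≗g = cong₂ _+_ (f≗g 0) (Σ<-cong m (f≗g ∘ suc))

Σ<-*ˡ : (m : ℕ) (c : ℤ) (f : ℕ → ℤ) → Σ< m (λ k → c * f k) ≡ c * Σ< m f
Σ<-*ˡ zero    c f = sym (ℤₚ.*-zeroʳ c)
Σ<-*ˡ (suc m) c f = trans (cong (c * f 0 +_) (Σ<-*ˡ m c (f ∘ suc))) (sym (ℤₚ.*-distribˡ-+ c _ _))

Σ<-last : (m : ℕ) (f : ℕ → ℤ) → Σ< (suc m) f ≡ Σ< m f + f m
Σ<-last zero    f = trans (ℤₚ.+-identityʳ (f 0)) (sym (ℤₚ.+-identityˡ (f 0)))
Σ<-last (suc m) f = trans (cong (f 0 +_) (Σ<-last m (f ∘ suc))) (sym (ℤₚ.+-assoc (f 0) _ _))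

Σ<-point : (m d : ℕ) → d ℕ.< m → (g : ℕ → ℤ) → Σ< m (λ k → when (d ℕ.≟ k) (g k)) ≡ g d
Σ<-point (suc m) zero    _   g = trans (cong (g 0 +_) (Σ<-zero m)) (ℤₚ.+-identityʳ _)
  where
  Σ<-zero : (m : ℕ) → Σ< m (λ _ → 0ℤ) ≡ 0ℤ
  Σ<-zero zero    = refl
  Σ<-zero (suc m) = trans (ℤₚ.+-identityˡ _) (Σ<-zero m)
Σ<-point (suc m) (suc d) d<m g = trans (ℤₚ.+-identityˡ _) (Σ<-point m d (ℕₚ.≤-pred d<m) (g ∘ suc))

Σ<-when : (m : ℕ) {P : Set} (d : Dec P) (f : ℕ → ℤ) → Σ< m (λ k → when d (f k)) ≡ when d (Σ< m f)
Σ<-when zero    d f = sym (when-zero d)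
Σ<-when (suc m) d f = trans (cong (when d (f 0) +_) (Σ<-when m d (f ∘ suc))) (sym (when-+ d _ _))

Σ<-Σₛ : {n : ℕ} (m : ℕ) (f : ℕ → Subset n → ℤ) → Σ< m (λ k → Σₛ (f k)) ≡ Σₛ (λ A → Σ< m (λ k → f k A))
Σ<-Σₛ {n} zero    f = sym (Σₛ-zero {n})
Σ<-Σₛ {n} (suc m) f = trans (cong (Σₛ (f 0) +_) (Σ<-Σₛ m (f ∘ suc))) (sym (Σₛ-+ {n} (f 0) _))

sign-suc : ∀ m → sign (suc m) ≡ - sign m
sign-suc m = ℤₚ.-1*i≡-i (sign m)

Σₛ-sign-⊆ : {n : ℕ} (S : Subset n) → Σₛ (λ A → when (A ⊆? S) (sign ∣ A ∣)) ≡ when (S ≟ₛ ⊥) 1ℤ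
Σₛ-sign-⊆ [] = refl
Σₛ-sign-⊆ {suc n} (true ∷ S) = begin
  Σₛ (λ A → when (A ⊆? S) (sign (suc ∣ A ∣))) + X
    ≡⟨ cong (_+ X) (Σₛ-cong {n} (λ A → trans (cong (when (A ⊆? S)) (sign-suc ∣ A ∣)) (when-neg (A ⊆? S) _))) ⟩
  Σₛ (λ A → - when (A ⊆? S) (sign ∣ A ∣)) + X
    ≡⟨ cong (_+ X) (Σₛ-neg {n} _) ⟩
  - X + X
    ≡⟨ ℤₚ.+-inverseˡ X ⟩
  0ℤ ∎
  where
  open ≡-Reasoning
  X : ℤ
  X = Σₛ (λ A → when (A ⊆? S) (sign ∣ A ∣))
Σₛ-sign-⊆ {suc n} (false ∷ S) =
  trans (cong (_+ Σₛ (λ A → when (A ⊆? S) (sign ∣ A ∣))) (Σₛ-zero {n})) (trans (ℤₚ.+-identityˡ _) (Σₛ-sign-⊆ S))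

-- The reduced characteristic polynomial as a sum over subsets

qint-suc : (m : ℕ) (q : ℤ) → qint (suc m) q ≡ 1ℤ + q * qint m q
qint-suc m q = cong (1ℤ +_) (Σ<-*ˡ m q (q ℤ.^_))

weightedSum : (ℕ → ℤ) → List ℤ → ℤ
weightedSum w []       = 0ℤ
weightedSum w (x ∷ xs) = w 0 * x + weightedSum (w ∘ suc) xs

weightedSum-cong : {v w : ℕ → ℤ} → (∀ k → v k ≡ w k) → (xs : List ℤ) → weightedSum v xs ≡ weightedSum w xs
weightedSum-cong v≗w []       = refl
weightedSum-cong v≗w (x ∷ xs) = cong₂ (λ a b → a * x + b) (v≗w 0) (weightedSum-cong (v≗w ∘ suc) xs)

weightedSum-affine : (q : ℤ) (w : ℕ → ℤ) (xs : List ℤ) →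
                     weightedSum (λ k → 1ℤ + q * w k) xs ≡ sumℤ xs + q * weightedSum w xs
weightedSum-affine q w []       = sym (trans (ℤₚ.+-identityˡ _) (ℤₚ.*-zeroʳ q))
weightedSum-affine q w (x ∷ xs) =
  trans (cong ((1ℤ + q * w 0) * x +_) (weightedSum-affine q (w ∘ suc) xs)) (rearrange q x (w 0) (sumℤ xs) _)
  where
  rearrange : ∀ q x a s t → (1ℤ + q * a) * x + (s + q * t) ≡ (x + s) + q * (a * x + t)
  rearrange = solve-∀

weightedSum-applyUpTo : (w f : ℕ → ℤ) (m : ℕ) → weightedSum w (applyUpTo f m) ≡ Σ< m (λ k → w k * f k)
weightedSum-applyUpTo w f zero    = refl
weightedSum-applyUpTo w f (suc m) = cong (w 0 * f 0 +_) (weightedSum-applyUpTo (w ∘ suc) (f ∘ suc) m)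

evalPoly-suffixSums : (q : ℤ) (xs : List ℤ) → evalPoly (suffixSums xs) q ≡ weightedSum (λ k → qint (suc k) q) xs
evalPoly-suffixSums q []       = refl
evalPoly-suffixSums q (x ∷ xs) = begin
  (x + sumℤ xs) + q * evalPoly (suffixSums xs) q
    ≡⟨ cong (λ t → (x + sumℤ xs) + q * t) (evalPoly-suffixSums q xs) ⟩
  (x + sumℤ xs) + q * weightedSum (λ k → qint (suc k) q) xs
    ≡⟨ rearrange q x (sumℤ xs) _ ⟩
  qint 1 q * x + (sumℤ xs + q * weightedSum (λ k → qint (suc k) q) xs)
    ≡⟨ cong (qint 1 q * x +_) (weightedSum-affine q (λ k → qint (suc k) q) xs) ⟨
  qint 1 q * x + weightedSum (λ k → 1ℤ + q * qint (suc k) q) xs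
    ≡⟨ cong (qint 1 q * x +_) (weightedSum-cong (λ k → qint-suc (suc k) q) xs) ⟨
  qint 1 q * x + weightedSum (λ k → qint (suc (suc k)) q) xs ∎
  where
  open ≡-Reasoning
  rearrange : ∀ q x s t → (x + s) + q * t ≡ (1ℤ + 0ℤ) * x + (s + q * t)
  rearrange = solve-∀

-- Division by q - 1 sends q^k to [k]_q, up to the dropped remainder.
evalPoly-divByQminus1 : (q : ℤ) (cs : List ℤ) → evalPoly (divByQminus1 cs) q ≡ weightedSum (λ k → qint k q) cs
evalPoly-divByQminus1 q []       = refl
evalPoly-divByQminus1 q (c ∷ cs) = sym (trans (cong (_+ weightedSum (λ k → qint (suc k) q) cs) (ℤₚ.*-zeroˡ c))
                                               (trans (ℤₚ.+-identityˡ _) (sym (evalPoly-suffixSums q cs))))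

redCharPoly≡Σₛ : {n : ℕ} (E : Subset n) (rk : Subset n → ℕ) (q : ℤ) →
                 redCharPoly E rk q ≡ Σₛ (λ A → when (A ⊆? E) (sign ∣ A ∣ * qint (rk E ∸ rk A) q))
redCharPoly≡Σₛ {n} E rk q = begin
  evalPoly (divByQminus1 (applyUpTo coeff (suc r))) q
    ≡⟨ evalPoly-divByQminus1 q (applyUpTo coeff (suc r)) ⟩
  weightedSum (λ k → qint k q) (applyUpTo coeff (suc r))
    ≡⟨ weightedSum-applyUpTo (λ k → qint k q) coeff (suc r) ⟩
  Σ< (suc r) (λ k → qint k q * coeff k)
    ≡⟨ Σ<-cong (suc r) coeff-as-Σₛ ⟩
  Σ< (suc r) (λ k → Σₛ (λ A → when (A ⊆? E) (when (r ∸ rk A ℕ.≟ k) (qint k q * sign ∣ A ∣))))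
    ≡⟨ Σ<-Σₛ {n} (suc r) (λ k A → when (A ⊆? E) (when (r ∸ rk A ℕ.≟ k) (qint k q * sign ∣ A ∣))) ⟩
  Σₛ (λ A → Σ< (suc r) (λ k → when (A ⊆? E) (when (r ∸ rk A ℕ.≟ k) (qint k q * sign ∣ A ∣))))
    ≡⟨ Σₛ-cong {n} only-k≡r∸rkA ⟩
  Σₛ (λ A → when (A ⊆? E) (sign ∣ A ∣ * qint (rk E ∸ rk A) q)) ∎
  where
  open ≡-Reasoning
  r : ℕ
  r = rk E
  coeff : ℕ → ℤ
  coeff k = sumℤ (map (λ A → sign ∣ A ∣) (filter (λ A → (r ∸ rk A) ℕ.≟ k) (subsetsOf E)))
  coeff-as-Σₛ : ∀ k → qint k q * coeff k
                ≡ Σₛ (λ A → when (A ⊆? E) (when (r ∸ rk A ℕ.≟ k) (qint k q * sign ∣ A ∣)))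
  coeff-as-Σₛ k = begin
    qint k q * coeff k
      ≡⟨ sumMap-*ˡ (qint k q) (λ A → sign ∣ A ∣) (filter (λ A → (r ∸ rk A) ℕ.≟ k) (subsetsOf E)) ⟨
    sumMap (λ A → qint k q * sign ∣ A ∣) (filter (λ A → (r ∸ rk A) ℕ.≟ k) (subsetsOf E))
      ≡⟨ sumMap-filter (λ A → (r ∸ rk A) ℕ.≟ k) _ (subsetsOf E) ⟩
    sumMap (λ A → when (r ∸ rk A ℕ.≟ k) (qint k q * sign ∣ A ∣)) (subsetsOf E)
      ≡⟨ sumMap-filter (_⊆? E) _ (allSubsets n) ⟩
    sumMap (λ A → when (A ⊆? E) (when (r ∸ rk A ℕ.≟ k) (qint k q * sign ∣ A ∣))) (allSubsets n)
      ≡⟨ sumMap-allSubsets n _ ⟩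
    Σₛ (λ A → when (A ⊆? E) (when (r ∸ rk A ℕ.≟ k) (qint k q * sign ∣ A ∣))) ∎
  only-k≡r∸rkA : ∀ A → Σ< (suc r) (λ k → when (A ⊆? E) (when (r ∸ rk A ℕ.≟ k) (qint k q * sign ∣ A ∣)))
                       ≡ when (A ⊆? E) (sign ∣ A ∣ * qint (r ∸ rk A) q)
  only-k≡r∸rkA A = begin
    Σ< (suc r) (λ k → when (A ⊆? E) (when (r ∸ rk A ℕ.≟ k) (qint k q * sign ∣ A ∣)))
      ≡⟨ Σ<-when (suc r) (A ⊆? E) (λ k → when (r ∸ rk A ℕ.≟ k) (qint k q * sign ∣ A ∣)) ⟩
    when (A ⊆? E) (Σ< (suc r) (λ k → when (r ∸ rk A ℕ.≟ k) (qint k q * sign ∣ A ∣)))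
      ≡⟨ cong (when (A ⊆? E)) (Σ<-point (suc r) (r ∸ rk A) (ℕ.s≤s (ℕₚ.m∸n≤m r (rk A)))
                                          (λ k → qint k q * sign ∣ A ∣)) ⟩
    when (A ⊆? E) (qint (r ∸ rk A) q * sign ∣ A ∣)
      ≡⟨ cong (when (A ⊆? E)) (ℤₚ.*-comm (qint (r ∸ rk A) q) (sign ∣ A ∣)) ⟩
    when (A ⊆? E) (sign ∣ A ∣ * qint (r ∸ rk A) q) ∎

-- Closure and flats

module _ {n : ℕ} where

  ∪-⊆ : {A B C : Subset n} → A ⊆ C → B ⊆ C → A ∪ B ⊆ C
  ∪-⊆ {A} {B} A⊆C B⊆C x∈A∪B with x∈p∪q⁻ A B x∈A∪B
  ... | inj₁ x∈A = A⊆C x∈A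
  ... | inj₂ x∈B = B⊆C x∈B

  ⁅⁆-⊆ : {i : Fin n} {C : Subset n} → i ∈ C → ⁅ i ⁆ ⊆ C
  ⁅⁆-⊆ {i} i∈C x∈⁅i⁆ = subst (_∈ _) (sym (x∈⁅y⁆⇒x≡y i x∈⁅i⁆)) i∈C

  ∪-⁅⁆-absorb : {A : Subset n} {i : Fin n} → i ∈ A → A ∪ ⁅ i ⁆ ≡ A
  ∪-⁅⁆-absorb i∈A = ⊆-antisym (∪-⊆ ⊆-refl (⁅⁆-⊆ i∈A)) (p⊆p∪q _)

  ∪-absorbˡ : {A B : Subset n} → A ⊆ B → A ∪ B ≡ B
  ∪-absorbˡ {A} A⊆B = ⊆-antisym (∪-⊆ A⊆B ⊆-refl) (q⊆p∪q A _)

x∈p─q⇒x∉q : {n : ℕ} {x : Fin n} (p q : Subset n) → x ∈ p ─ q → x ∉ q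
x∈p─q⇒x∉q (outside ∷ p) (inside ∷ q) () here
x∈p─q⇒x∉q (inside ∷ p)  (inside ∷ q) () here
x∈p─q⇒x∉q (s ∷ p) (t ∷ q) (there x∈p─q) (there x∈q) = x∈p─q⇒x∉q p q x∈p─q x∈q

module _ {n : ℕ} where

  ⊆∧≢⇒⊂ : {p q : Subset n} → p ⊆ q → p ≢ q → p ⊂ q
  ⊆∧≢⇒⊂ {p} {q} p⊆q p≢q with nonempty? (q ─ p)
  ... | yes (x , x∈q─p) = p⊆q , x , p─q⊆p q p x∈q─p , x∈p─q⇒x∉q q p x∈q─p
  ... | no q─p-empty = contradiction (⊆-antisym p⊆q q⊆p) p≢q
    where
    q⊆p : q ⊆ p
    q⊆p {x} x∈q with x ∈? p
    ... | yes x∈p = x∈p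
    ... | no  x∉p = contradiction (x , x∈p∧x∉q⇒x∈p─q x∈q x∉p) q─p-empty

  when-⊆ : (p q : Subset n) → ∀ x → when (p ⊆? q) x ≡ when (p ≟ₛ q) x + when (p ⊂? q) x
  when-⊆ p q x with p ⊆? q | p ≟ₛ q | p ⊂? q
  ... | yes _   | yes refl | yes p⊂p = contradiction p⊂p (⊂-irref refl)
  ... | yes _   | yes refl | no _    = sym (ℤₚ.+-identityʳ x)
  ... | yes _   | no _     | yes _   = sym (ℤₚ.+-identityˡ x)
  ... | yes p⊆q | no p≢q   | no p⊄q  = contradiction (⊆∧≢⇒⊂ p⊆q p≢q) p⊄q
  ... | no p⊈q  | yes refl | _       = ⊥-elim (p⊈q ⊆-refl)
  ... | no p⊈q  | no _     | yes p⊂q = ⊥-elim (p⊈q (proj₁ p⊂q))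
  ... | no _    | no _     | no _    = refl

  ─-⊆-∪ : {A F E : Subset n} → F ⊆ E → A ⊆ E ─ F → A ∪ F ⊆ E
  ─-⊆-∪ {F = F} {E} F⊆E A⊆E─F = ∪-⊆ (⊆-trans A⊆E─F (p─q⊆p E F)) F⊆E

  ─-∪-cancel : {F E : Subset n} → F ⊆ E → (E ─ F) ∪ F ≡ E
  ─-∪-cancel {F} {E} F⊆E = ⊆-antisym (─-⊆-∪ F⊆E ⊆-refl) E⊆E─F∪F
    where
    E⊆E─F∪F : E ⊆ (E ─ F) ∪ F
    E⊆E─F∪F {x} x∈E with x ∈? F
    ... | yes x∈F = q⊆p∪q (E ─ F) F x∈F
    ... | no  x∉F = p⊆p∪q F (x∈p∧x∉q⇒x∈p─q x∈E x∉F)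

  ─≡⊥⇔≡ : {F H : Subset n} → F ⊆ H → (H ─ F ≡ ⊥ ⇔ H ≡ F)
  ─≡⊥⇔≡ {F} {H} F⊆H = mk⇔ (λ H─F≡⊥ → ⊆-antisym (H⊆F H─F≡⊥) F⊆H) (λ { refl → H─H≡⊥ })
    where
    H⊆F : H ─ F ≡ ⊥ → H ⊆ F
    H⊆F H─F≡⊥ {x} x∈H with x ∈? F
    ... | yes x∈F = x∈F
    ... | no  x∉F = contradiction (subst (x ∈_) H─F≡⊥ (x∈p∧x∉q⇒x∈p─q x∈H x∉F)) ∉⊥
    H─H≡⊥ : H ─ H ≡ ⊥
    H─H≡⊥ = ⊆-antisym (λ x∈H─H → contradiction (p─q⊆p H H x∈H─H) (x∈p─q⇒x∉q H H x∈H─H)) ⊥⊆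

Spans : {n : ℕ} → (Subset n → ℕ) → Subset n → Fin n → Set
Spans rk X i = rk (X ∪ ⁅ i ⁆) ≡ rk X

module _ {n : ℕ} (E : Subset n) (rk : Subset n → ℕ) where

  ∈cl⁻ : {A : Subset n} {i : Fin n} → i ∈ cl E rk A → i ∈ E × Spans rk A i
  ∈cl⁻ {A} {i} i∈cl = lookup⇒[]= i E (Equivalence.to Boolₚ.T-≡ (proj₁ conj)) , ℕₚ.≡ᵇ⇒≡ _ _ (proj₂ conj)
    where
    conj : T (lookup E i) × T (rk (A ∪ ⁅ i ⁆) ℕ.≡ᵇ rk A)
    conj = Equivalence.to Boolₚ.T-∧
      (subst T (lookup∘tabulate _ i) (Equivalence.from Boolₚ.T-≡ ([]=⇒lookup i∈cl)))

  ∈cl⁺ : {A : Subset n} {i : Fin n} → i ∈ E → Spans rk A i → i ∈ cl E rk A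
  ∈cl⁺ {A} {i} i∈E spans = lookup⇒[]= i (cl E rk A) (trans (lookup∘tabulate _ i)
    (Equivalence.to Boolₚ.T-≡ (Equivalence.from Boolₚ.T-∧
      (Equivalence.from Boolₚ.T-≡ ([]=⇒lookup i∈E) , ℕₚ.≡⇒≡ᵇ _ _ spans))))

  Spans-∈ : {A : Subset n} {i : Fin n} → i ∈ A → Spans rk A i
  Spans-∈ i∈A = cong rk (∪-⁅⁆-absorb i∈A)

  isFlat-closed : {A : Subset n} {i : Fin n} → IsFlat E rk A → i ∈ E → Spans rk A i → i ∈ A
  isFlat-closed {i = i} (_ , cl≡A) i∈E spans = subst (i ∈_) cl≡A (∈cl⁺ i∈E spans)

  isFlat-intro : {A : Subset n} → A ⊆ E → (∀ {i} → i ∈ E → Spans rk A i → i ∈ A) → IsFlat E rk A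
  isFlat-intro {A} A⊆E closed = A⊆E , ⊆-antisym cl⊆A (λ i∈A → ∈cl⁺ (A⊆E i∈A) (Spans-∈ i∈A))
    where
    cl⊆A : cl E rk A ⊆ A
    cl⊆A i∈cl = closed (proj₁ (∈cl⁻ i∈cl)) (proj₂ (∈cl⁻ i∈cl))

  isFlat-ground : IsFlat E rk E
  isFlat-ground = isFlat-intro ⊆-refl (λ i∈E _ → i∈E)

module Closure {n : ℕ} {E : Subset n} {rk : Subset n → ℕ} (M : IsMatroid E rk) where
  open IsMatroid M

  rk-⊥ : rk ⊥ ≡ 0
  rk-⊥ = ℕₚ.n≤0⇒n≡0 (subst (rk ⊥ ℕ.≤_) (∣⊥∣≡0 n) (rk-bound ⊥ ⊥⊆))

  Spans-mono : {X Y : Subset n} {i : Fin n} → X ⊆ Y → Y ⊆ E → i ∈ E → Spans rk X i → Spans rk Y i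
  Spans-mono {X} {Y} {i} X⊆Y Y⊆E i∈E X-spans =
    ℕₚ.≤-antisym (ℕₚ.+-cancelʳ-≤ (rk X) _ _ submodular) (rk-mono Y (Y ∪ ⁅ i ⁆) (p⊆p∪q _) Y∪i⊆E)
    where
    open ℕₚ.≤-Reasoning
    P : Subset n
    P = X ∪ ⁅ i ⁆
    P⊆E : P ⊆ E
    P⊆E = ∪-⊆ (⊆-trans X⊆Y Y⊆E) (⁅⁆-⊆ i∈E)
    Y∪i⊆E : Y ∪ ⁅ i ⁆ ⊆ E
    Y∪i⊆E = ∪-⊆ Y⊆E (⁅⁆-⊆ i∈E)
    Y∪i⊆P∪Y : Y ∪ ⁅ i ⁆ ⊆ P ∪ Y
    Y∪i⊆P∪Y = ∪-⊆ (q⊆p∪q P Y) (⊆-trans (q⊆p∪q X ⁅ i ⁆) (p⊆p∪q Y))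
    X⊆P∩Y : X ⊆ P ∩ Y
    X⊆P∩Y x∈X = x∈p∩q⁺ (p⊆p∪q ⁅ i ⁆ x∈X , X⊆Y x∈X)
    submodular : rk (Y ∪ ⁅ i ⁆) ℕ.+ rk X ℕ.≤ rk Y ℕ.+ rk X
    submodular = begin
      rk (Y ∪ ⁅ i ⁆) ℕ.+ rk X
        ≤⟨ ℕₚ.+-mono-≤ (rk-mono _ _ Y∪i⊆P∪Y (∪-⊆ P⊆E Y⊆E))
                       (rk-mono _ _ X⊆P∩Y (⊆-trans (p∩q⊆p P Y) P⊆E)) ⟩
      rk (P ∪ Y) ℕ.+ rk (P ∩ Y)
        ≤⟨ rk-submod P Y P⊆E Y⊆E ⟩
      rk P ℕ.+ rk Y
        ≡⟨ cong (ℕ._+ rk Y) X-spans ⟩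
      rk X ℕ.+ rk Y
        ≡⟨ ℕₚ.+-comm (rk X) (rk Y) ⟩
      rk Y ℕ.+ rk X ∎

  rk-∪-spanned : {X : Subset n} → X ⊆ E → (Y : Subset n) → Y ⊆ E →
                 (∀ {y} → y ∈ Y → Spans rk X y) → rk (X ∪ Y) ≡ rk X
  rk-∪-spanned {X} X⊆E = All.wfRec ⊂-wellFounded 0ℓ P step
    where
    P : Subset n → Set
    P Y = Y ⊆ E → (∀ {y} → y ∈ Y → Spans rk X y) → rk (X ∪ Y) ≡ rk X
    step : ∀ Y → (∀ {Y′} → Y′ ⊂ Y → P Y′) → P Y
    step Y rec Y⊆E spanned with nonempty? Y
    ... | no Y-empty = cong rk (⊆-antisym (∪-⊆ ⊆-refl (λ y∈Y → contradiction (_ , y∈Y) Y-empty)) (p⊆p∪q Y))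
    ... | yes (y , y∈Y) = ℕₚ.≤-antisym (begin
      rk (X ∪ Y)               ≤⟨ rk-mono _ _ X∪Y⊆X∪Y′∪y (∪-⊆ X∪Y′⊆E (⁅⁆-⊆ (Y⊆E y∈Y))) ⟩
      rk ((X ∪ Y′) ∪ ⁅ y ⁆)    ≡⟨ Spans-mono (p⊆p∪q Y′) X∪Y′⊆E (Y⊆E y∈Y) (spanned y∈Y) ⟩
      rk (X ∪ Y′)              ≡⟨ rec (x∈p⇒p-x⊂p y∈Y) Y′⊆E (spanned ∘ Y′⊆Y) ⟩
      rk X                     ∎) (rk-mono X (X ∪ Y) (p⊆p∪q Y) (∪-⊆ X⊆E Y⊆E))
      where
      open ℕₚ.≤-Reasoning
      Y′ : Subset n
      Y′ = Y -ₛ y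
      Y′⊆Y : Y′ ⊆ Y
      Y′⊆Y = p─q⊆p Y ⁅ y ⁆
      Y′⊆E : Y′ ⊆ E
      Y′⊆E = ⊆-trans Y′⊆Y Y⊆E
      X∪Y′⊆E : X ∪ Y′ ⊆ E
      X∪Y′⊆E = ∪-⊆ X⊆E Y′⊆E
      X∪Y⊆X∪Y′∪y : X ∪ Y ⊆ (X ∪ Y′) ∪ ⁅ y ⁆
      X∪Y⊆X∪Y′∪y {x} x∈X∪Y with x∈p∪q⁻ X Y x∈X∪Y | x Finₚ.≟ y
      ... | inj₁ x∈X | _        = p⊆p∪q ⁅ y ⁆ (p⊆p∪q Y′ x∈X)
      ... | inj₂ _   | yes refl = q⊆p∪q (X ∪ Y′) ⁅ y ⁆ (x∈⁅x⁆ y)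
      ... | inj₂ x∈Y | no x≢y   = p⊆p∪q ⁅ y ⁆ (q⊆p∪q X Y′ (x∈p∧x≢y⇒x∈p-y x∈Y x≢y))

  cl-⊆ : (X : Subset n) → cl E rk X ⊆ E
  cl-⊆ X i∈cl = proj₁ (∈cl⁻ E rk i∈cl)

  ⊆-cl : {X : Subset n} → X ⊆ E → X ⊆ cl E rk X
  ⊆-cl X⊆E x∈X = ∈cl⁺ E rk (X⊆E x∈X) (Spans-∈ E rk x∈X)

  rk-cl : {X : Subset n} → X ⊆ E → rk (cl E rk X) ≡ rk X
  rk-cl {X} X⊆E = ℕₚ.≤-antisym (begin
    rk (cl E rk X)      ≤⟨ rk-mono _ _ (q⊆p∪q X (cl E rk X)) (∪-⊆ X⊆E (cl-⊆ X)) ⟩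
    rk (X ∪ cl E rk X)  ≡⟨ rk-∪-spanned X⊆E (cl E rk X) (cl-⊆ X) (λ i∈cl → proj₂ (∈cl⁻ E rk i∈cl)) ⟩
    rk X                ∎) (rk-mono _ _ (⊆-cl X⊆E) (cl-⊆ X))
    where open ℕₚ.≤-Reasoning

  cl-isFlat : {X : Subset n} → X ⊆ E → IsFlat E rk (cl E rk X)
  cl-isFlat {X} X⊆E = isFlat-intro E rk (cl-⊆ X) closed
    where
    open ℕₚ.≤-Reasoning
    closed : ∀ {i} → i ∈ E → Spans rk (cl E rk X) i → i ∈ cl E rk X
    closed {i} i∈E cl-spans = ∈cl⁺ E rk i∈E (ℕₚ.≤-antisym (begin
      rk (X ∪ ⁅ i ⁆)            ≤⟨ rk-mono _ _ (∪-⊆ (⊆-trans (⊆-cl X⊆E) (p⊆p∪q ⁅ i ⁆)) (q⊆p∪q _ ⁅ i ⁆))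
                                               (∪-⊆ (cl-⊆ X) (⁅⁆-⊆ i∈E)) ⟩
      rk (cl E rk X ∪ ⁅ i ⁆)    ≡⟨ cl-spans ⟩
      rk (cl E rk X)            ≡⟨ rk-cl X⊆E ⟩
      rk X                      ∎) (rk-mono _ _ (p⊆p∪q ⁅ i ⁆) (∪-⊆ X⊆E (⁅⁆-⊆ i∈E))))

  cl-mono : {X Y : Subset n} → X ⊆ Y → Y ⊆ E → cl E rk X ⊆ cl E rk Y
  cl-mono X⊆Y Y⊆E i∈clX with ∈cl⁻ E rk i∈clX
  ... | i∈E , X-spans = ∈cl⁺ E rk i∈E (Spans-mono X⊆Y Y⊆E i∈E X-spans)

  cl-least : {X H : Subset n} → IsFlat E rk H → X ⊆ H → cl E rk X ⊆ H
  cl-least {H = H} (H⊆E , clH≡H) X⊆H i∈clX = subst (_ ∈_) clH≡H (cl-mono X⊆H H⊆E i∈clX)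

  isFlat-restriction⁻ : {W A : Subset n} → IsFlat E rk W → IsFlat W rk A → IsFlat E rk A
  isFlat-restriction⁻ {W} {A} W-flat A-flat = isFlat-intro E rk (⊆-trans (proj₁ A-flat) (proj₁ W-flat)) closed
    where
    closed : ∀ {i} → i ∈ E → Spans rk A i → i ∈ A
    closed i∈E A-spans = isFlat-closed W rk A-flat
      (isFlat-closed E rk W-flat i∈E (Spans-mono (proj₁ A-flat) (proj₁ W-flat) i∈E A-spans)) A-spans

  isFlat-restriction⁺ : {W A : Subset n} → IsFlat E rk W → IsFlat E rk A → A ⊆ W → IsFlat W rk A
  isFlat-restriction⁺ {W} W-flat A-flat A⊆W =
    isFlat-intro W rk A⊆W (λ i∈W → isFlat-closed E rk A-flat (proj₁ W-flat i∈W))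

  cl-⊥-loopless : Loopless E rk → {W : Subset n} → W ⊆ E → cl W rk ⊥ ≡ ⊥
  cl-⊥-loopless loopless {W} W⊆E = ⊆-antisym cl⊥⊆⊥ ⊥⊆
    where
    cl⊥⊆⊥ : cl W rk ⊥ ⊆ ⊥
    cl⊥⊆⊥ i∈cl with ∈cl⁻ W rk i∈cl
    ... | i∈W , ⊥-spans = contradiction
      (trans (sym (loopless _ (W⊆E i∈W))) (trans (cong rk (sym (∪-identityˡ _))) (trans ⊥-spans rk-⊥)))
      (λ ())

-- The Möbius function of the lattice of flats

module Möbius {n : ℕ} {E : Subset n} {rk : Subset n → ℕ} (M : IsMatroid E rk) where
  open Closure M

  flat? : (F : Subset n) → Dec (IsFlat E rk F)
  flat? = isFlat? E rk

  -- By Whitney's formula this is the Möbius function μ(F, H) of the lattice of flats.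
  μ : Subset n → Subset n → ℤ
  μ F H = Σₛ (λ A → when (cl E rk (A ∪ F) ≟ₛ H) (when (A ⊆? E ─ F) (sign ∣ A ∣)))

  μ-vanishes : {F H : Subset n} → (∀ {A} → A ⊆ E ─ F → cl E rk (A ∪ F) ≢ H) → μ F H ≡ 0ℤ
  μ-vanishes {F} {H} never = trans (Σₛ-cong {n} term≡0) (Σₛ-zero {n})
    where
    term≡0 : ∀ A → when (cl E rk (A ∪ F) ≟ₛ H) (when (A ⊆? E ─ F) (sign ∣ A ∣)) ≡ 0ℤ
    term≡0 A with cl E rk (A ∪ F) ≟ₛ H | A ⊆? E ─ F
    ... | yes cl≡H | yes A⊆E─F = contradiction cl≡H (never A⊆E─F)
    ... | yes _    | no _      = refl
    ... | no _     | _         = refl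

  μ-⊈ : {F H : Subset n} → F ⊆ E → ¬ F ⊆ H → μ F H ≡ 0ℤ
  μ-⊈ {F} F⊆E F⊈H = μ-vanishes λ A⊆E─F cl≡H →
    F⊈H (subst (F ⊆_) cl≡H (⊆-trans (q⊆p∪q _ F) (⊆-cl (─-⊆-∪ F⊆E A⊆E─F))))

  μ-nonflat : {F H : Subset n} → F ⊆ E → ¬ IsFlat E rk H → μ F H ≡ 0ℤ
  μ-nonflat F⊆E H-nonflat = μ-vanishes λ A⊆E─F cl≡H →
    H-nonflat (subst (IsFlat E rk) cl≡H (cl-isFlat (─-⊆-∪ F⊆E A⊆E─F)))

  Σ-μ-below : {F H : Subset n} → IsFlat E rk H → F ⊆ H →
              Σₛ (λ H′ → when (H′ ⊆? H) (μ F H′)) ≡ when (H ≟ₛ F) 1ℤ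
  Σ-μ-below {F} {H} H-flat F⊆H = begin
    Σₛ (λ H′ → when (H′ ⊆? H) (μ F H′))
      ≡⟨ Σₛ-cong {n} (λ H′ → trans (cong (when (H′ ⊆? H)) (sym (ℤₚ.*-identityˡ _))) (sym (when-*ʳ (H′ ⊆? H) 1ℤ _))) ⟩
    Σₛ (λ H′ → when (H′ ⊆? H) 1ℤ * μ F H′)
      ≡⟨ Σₛ-fibres (λ A → cl E rk (A ∪ F)) (λ A → when (A ⊆? E ─ F) (sign ∣ A ∣)) (λ H′ → when (H′ ⊆? H) 1ℤ) ⟨
    Σₛ (λ A → when (A ⊆? E ─ F) (sign ∣ A ∣) * when (cl E rk (A ∪ F) ⊆? H) 1ℤ)
      ≡⟨ Σₛ-cong {n} term ⟩
    Σₛ (λ A → when (A ⊆? H ─ F) (sign ∣ A ∣))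
      ≡⟨ Σₛ-sign-⊆ (H ─ F) ⟩
    when (H ─ F ≟ₛ ⊥) 1ℤ
      ≡⟨ when-⇔ (H ─ F ≟ₛ ⊥) (H ≟ₛ F) (Equivalence.to (─≡⊥⇔≡ F⊆H)) (Equivalence.from (─≡⊥⇔≡ F⊆H)) 1ℤ ⟩
    when (H ≟ₛ F) 1ℤ ∎
    where
    open ≡-Reasoning
    F⊆E : F ⊆ E
    F⊆E = ⊆-trans F⊆H (proj₁ H-flat)
    term : ∀ A → when (A ⊆? E ─ F) (sign ∣ A ∣) * when (cl E rk (A ∪ F) ⊆? H) 1ℤ ≡ when (A ⊆? H ─ F) (sign ∣ A ∣)
    term A with A ⊆? E ─ F | A ⊆? H ─ F
    ... | yes A⊆E─F | yes A⊆H─F =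
      trans (cong (sign ∣ A ∣ *_) (when-yes (cl E rk (A ∪ F) ⊆? H) cl⊆H 1ℤ)) (ℤₚ.*-identityʳ (sign ∣ A ∣))
      where
      cl⊆H : cl E rk (A ∪ F) ⊆ H
      cl⊆H = cl-least H-flat (∪-⊆ (⊆-trans A⊆H─F (p─q⊆p H F)) F⊆H)
    ... | yes A⊆E─F | no A⊈H─F =
      trans (cong (sign ∣ A ∣ *_) (when-no (cl E rk (A ∪ F) ⊆? H) cl⊈H 1ℤ)) (ℤₚ.*-zeroʳ (sign ∣ A ∣))
      where
      cl⊈H : ¬ cl E rk (A ∪ F) ⊆ H
      cl⊈H cl⊆H = A⊈H─F λ x∈A → x∈p∧x∉q⇒x∈p─q
        (cl⊆H (⊆-cl (─-⊆-∪ F⊆E A⊆E─F) (p⊆p∪q F x∈A))) (x∈p─q⇒x∉q E F (A⊆E─F x∈A))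
    ... | no A⊈E─F | yes A⊆H─F = ⊥-elim (A⊈E─F λ x∈A →
      x∈p∧x∉q⇒x∈p─q (proj₁ H-flat (p─q⊆p H F (A⊆H─F x∈A))) (x∈p─q⇒x∉q H F (A⊆H─F x∈A)))
    ... | no _ | no _ = ℤₚ.*-zeroˡ (when (cl E rk (A ∪ F) ⊆? H) 1ℤ)

  μ-rec : {F H : Subset n} → IsFlat E rk H → F ⊆ H →
          μ F H ≡ when (H ≟ₛ F) 1ℤ - Σₛ (λ H′ → when (H′ ⊂? H) (μ F H′))
  μ-rec {F} {H} H-flat F⊆H = begin
    μ F H
      ≡⟨ cancel (μ F H) strictly-below ⟨
    μ F H + strictly-below - strictly-below
      ≡⟨ cong (_- strictly-below) (cong₂ _+_ (sym (Σₛ-point H (μ F))) refl) ⟩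
    Σₛ (λ H′ → when (H′ ≟ₛ H) (μ F H′)) + strictly-below - strictly-below
      ≡⟨ cong (_- strictly-below) (Σₛ-+ {n} _ _) ⟨
    Σₛ (λ H′ → when (H′ ≟ₛ H) (μ F H′) + when (H′ ⊂? H) (μ F H′)) - strictly-below
      ≡⟨ cong (_- strictly-below) (Σₛ-cong {n} (λ H′ → when-⊆ H′ H (μ F H′))) ⟨
    Σₛ (λ H′ → when (H′ ⊆? H) (μ F H′)) - strictly-below
      ≡⟨ cong (_- strictly-below) (Σ-μ-below H-flat F⊆H) ⟩
    when (H ≟ₛ F) 1ℤ - strictly-below ∎
    where
    open ≡-Reasoning
    strictly-below : ℤ
    strictly-below = Σₛ (λ H′ → when (H′ ⊂? H) (μ F H′))
    cancel : ∀ a b → a + b - b ≡ a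
    cancel = solve-∀

  when-μ : {P P′ : Set} (d : Dec P) (d′ : Dec P′) {F H : Subset n} →
           (P → F ⊆ E) → (P′ → P) → (P → F ⊆ H → P′) → when d (μ F H) ≡ when d′ (μ F H)
  when-μ d d′ {F} {H} F⊆E P′⇒P P∧F⊆H⇒P′ with F ⊆? H
  ... | yes F⊆H = when-⇔ d d′ (λ p → P∧F⊆H⇒P′ p F⊆H) P′⇒P (μ F H)
  ... | no  F⊈H = begin
    when d (μ F H)     ≡⟨ when-cong d (λ p → μ-⊈ (F⊆E p) F⊈H) ⟩
    when d 0ℤ          ≡⟨ when-zero d ⟩
    0ℤ                 ≡⟨ when-zero d′ ⟨
    when d′ 0ℤ         ≡⟨ when-cong d′ (λ p′ → μ-⊈ (F⊆E (P′⇒P p′)) F⊈H) ⟨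
    when d′ (μ F H)    ∎
    where open ≡-Reasoning

  flatBetween? : (Z F H : Subset n) → Dec (IsFlat E rk F × Z ⊆ F × F ⊆ H)
  flatBetween? Z F H = flat? F ×-dec (Z ⊆? F ×-dec F ⊆? H)

  Σμ : Subset n → Subset n → ℤ
  Σμ Z H = Σₛ (λ F → when (flatBetween? Z F H) (μ F H))

  Σμ-nonflat : {Z H : Subset n} → IsFlat E rk Z → ¬ IsFlat E rk H → Σμ Z H ≡ when (Z ≟ₛ H) 1ℤ
  Σμ-nonflat {Z} {H} Z-flat H-nonflat = begin
    Σμ Z H
      ≡⟨ Σₛ-cong {n} (λ F → when-cong (flatBetween? Z F H) (λ (F-flat , _) → μ-nonflat (proj₁ F-flat) H-nonflat)) ⟩
    Σₛ (λ F → when (flatBetween? Z F H) 0ℤ)  ≡⟨ Σₛ-cong {n} (λ F → when-zero (flatBetween? Z F H)) ⟩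
    Σₛ {n} (λ _ → 0ℤ)                        ≡⟨ Σₛ-zero {n} ⟩
    0ℤ                                       ≡⟨ when-no (Z ≟ₛ H) (λ Z≡H → H-nonflat (subst (IsFlat E rk) Z≡H Z-flat)) 1ℤ ⟨
    when (Z ≟ₛ H) 1ℤ                         ∎
    where open ≡-Reasoning

  Σμ-flat : {Z H : Subset n} → IsFlat E rk Z → IsFlat E rk H →
            (∀ {H′} → H′ ⊂ H → Σμ Z H′ ≡ when (Z ≟ₛ H′) 1ℤ) → Σμ Z H ≡ when (Z ≟ₛ H) 1ℤ
  Σμ-flat {Z} {H} Z-flat H-flat Σμ-below-H = begin
    Σₛ (λ F → when (between F) (μ F H))
      ≡⟨ Σₛ-cong {n} (λ F → when-cong (between F) (λ (_ , _ , F⊆H) → μ-rec H-flat F⊆H)) ⟩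
    Σₛ (λ F → when (between F) (when (H ≟ₛ F) 1ℤ - S F))
      ≡⟨ Σₛ-cong {n} (λ F → when-- (between F) _ _) ⟩
    Σₛ (λ F → when (between F) (when (H ≟ₛ F) 1ℤ) - when (between F) (S F))
      ≡⟨ Σₛ-- {n} _ _ ⟩
    Σₛ (λ F → when (between F) (when (H ≟ₛ F) 1ℤ)) - Σₛ (λ F → when (between F) (S F))
      ≡⟨ cong₂ _-_ diagonal strictly-below ⟩
    when (Z ⊆? H) 1ℤ - when (Z ⊂? H) 1ℤ
      ≡⟨ cong (_- when (Z ⊂? H) 1ℤ) (when-⊆ Z H 1ℤ) ⟩
    when (Z ≟ₛ H) 1ℤ + when (Z ⊂? H) 1ℤ - when (Z ⊂? H) 1ℤ
      ≡⟨ cancel (when (Z ≟ₛ H) 1ℤ) (when (Z ⊂? H) 1ℤ) ⟩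
    when (Z ≟ₛ H) 1ℤ ∎
    where
    open ≡-Reasoning
    cancel : ∀ a b → a + b - b ≡ a
    cancel = solve-∀
    between : (F : Subset n) → Dec (IsFlat E rk F × Z ⊆ F × F ⊆ H)
    between F = flatBetween? Z F H
    S : Subset n → ℤ
    S F = Σₛ (λ H′ → when (H′ ⊂? H) (μ F H′))
    diagonal : Σₛ (λ F → when (between F) (when (H ≟ₛ F) 1ℤ)) ≡ when (Z ⊆? H) 1ℤ
    diagonal = begin
      Σₛ (λ F → when (between F) (when (H ≟ₛ F) 1ℤ))
        ≡⟨ Σₛ-cong {n} (λ F → trans (when-comm (between F) (H ≟ₛ F) 1ℤ) (when-≟-sym H F _)) ⟩
      Σₛ (λ F → when (F ≟ₛ H) (when (between F) 1ℤ))
        ≡⟨ Σₛ-point H (λ F → when (between F) 1ℤ) ⟩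
      when (between H) 1ℤ
        ≡⟨ when-⇔ (between H) (Z ⊆? H) (proj₁ ∘ proj₂) (λ Z⊆H → H-flat , Z⊆H , ⊆-refl) 1ℤ ⟩
      when (Z ⊆? H) 1ℤ ∎
    strictly-below : Σₛ (λ F → when (between F) (S F)) ≡ when (Z ⊂? H) 1ℤ
    strictly-below = begin
      Σₛ (λ F → when (between F) (S F))
        ≡⟨ Σₛ-cong {n} (λ F → sym (Σₛ-when {n} (between F) _)) ⟩
      Σₛ (λ F → Σₛ (λ H′ → when (between F) (when (H′ ⊂? H) (μ F H′))))
        ≡⟨ Σₛ-swap {n} {n} _ ⟩
      Σₛ (λ H′ → Σₛ (λ F → when (between F) (when (H′ ⊂? H) (μ F H′))))
        ≡⟨ Σₛ-cong {n} (λ H′ → trans (Σₛ-cong {n} (λ F → when-comm (between F) (H′ ⊂? H) _))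
                                     (Σₛ-when {n} (H′ ⊂? H) _)) ⟩
      Σₛ (λ H′ → when (H′ ⊂? H) (Σₛ (λ F → when (between F) (μ F H′))))
        ≡⟨ Σₛ-cong {n} (λ H′ → when-cong (H′ ⊂? H) (λ H′⊂H →
                         trans (Σₛ-cong {n} (narrow H′⊂H)) (Σμ-below-H H′⊂H))) ⟩
      Σₛ (λ H′ → when (H′ ⊂? H) (when (Z ≟ₛ H′) 1ℤ))
        ≡⟨ Σₛ-cong {n} (λ H′ → trans (when-comm (H′ ⊂? H) (Z ≟ₛ H′) 1ℤ) (when-≟-sym Z H′ _)) ⟩
      Σₛ (λ H′ → when (H′ ≟ₛ Z) (when (H′ ⊂? H) 1ℤ))
        ≡⟨ Σₛ-point Z (λ H′ → when (H′ ⊂? H) 1ℤ) ⟩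
      when (Z ⊂? H) 1ℤ ∎
      where
      narrow : ∀ {H′} → H′ ⊂ H → ∀ F → when (between F) (μ F H′) ≡ when (flatBetween? Z F H′) (μ F H′)
      narrow {H′} H′⊂H F = when-μ (between F) (flatBetween? Z F H′) (proj₁ ∘ proj₁)
        (λ (F-flat , Z⊆F , F⊆H′) → F-flat , Z⊆F , ⊆-trans F⊆H′ (proj₁ H′⊂H))
        (λ (F-flat , Z⊆F , _) F⊆H′ → F-flat , Z⊆F , F⊆H′)

  Σμ≡δ : {Z : Subset n} → IsFlat E rk Z → ∀ H → Σμ Z H ≡ when (Z ≟ₛ H) 1ℤ
  Σμ≡δ {Z} Z-flat = All.wfRec ⊂-wellFounded 0ℓ (λ H → Σμ Z H ≡ when (Z ≟ₛ H) 1ℤ) step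
    where
    step : ∀ H → (∀ {H′} → H′ ⊂ H → Σμ Z H′ ≡ when (Z ≟ₛ H′) 1ℤ) → Σμ Z H ≡ when (Z ≟ₛ H) 1ℤ
    step H rec with flat? H
    ... | yes H-flat    = Σμ-flat Z-flat H-flat rec
    ... | no  H-nonflat = Σμ-nonflat Z-flat H-nonflat

  Σ-sign-by-closure : (φ : ℕ → ℤ) {F : Subset n} → F ⊆ E →
                      Σₛ (λ A → when (A ⊆? E ─ F) (sign ∣ A ∣) * φ (rk (A ∪ F))) ≡ Σₛ (λ H → φ (rk H) * μ F H)
  Σ-sign-by-closure φ {F} F⊆E = begin
    Σₛ (λ A → when (A ⊆? E ─ F) (sign ∣ A ∣) * φ (rk (A ∪ F)))
      ≡⟨ Σₛ-cong {n} rank-of-closure ⟩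
    Σₛ (λ A → when (A ⊆? E ─ F) (sign ∣ A ∣) * φ (rk (cl E rk (A ∪ F))))
      ≡⟨ Σₛ-fibres (λ A → cl E rk (A ∪ F)) (λ A → when (A ⊆? E ─ F) (sign ∣ A ∣)) (φ ∘ rk) ⟩
    Σₛ (λ H → φ (rk H) * μ F H) ∎
    where
    open ≡-Reasoning
    rank-of-closure : ∀ A → when (A ⊆? E ─ F) (sign ∣ A ∣) * φ (rk (A ∪ F))
                            ≡ when (A ⊆? E ─ F) (sign ∣ A ∣) * φ (rk (cl E rk (A ∪ F)))
    rank-of-closure A with A ⊆? E ─ F
    ... | yes A⊆E─F = cong (λ r → sign ∣ A ∣ * φ r) (sym (rk-cl (─-⊆-∪ F⊆E A⊆E─F)))
    ... | no  _     = trans (ℤₚ.*-zeroˡ (φ (rk (A ∪ F)))) (sym (ℤₚ.*-zeroˡ (φ (rk (cl E rk (A ∪ F))))))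

  möbius-inversion : (φ : ℕ → ℤ) {Z : Subset n} → IsFlat E rk Z →
    Σₛ (λ F → when (flat? F ×-dec Z ⊆? F) (Σₛ (λ A → when (A ⊆? E ─ F) (sign ∣ A ∣) * φ (rk (A ∪ F)))))
    ≡ φ (rk Z)
  möbius-inversion φ {Z} Z-flat = begin
    Σₛ (λ F → when (above F) (Σₛ (λ A → when (A ⊆? E ─ F) (sign ∣ A ∣) * φ (rk (A ∪ F)))))
      ≡⟨ Σₛ-cong {n} (λ F → when-cong (above F) (λ (F-flat , _) → Σ-sign-by-closure φ (proj₁ F-flat))) ⟩
    Σₛ (λ F → when (above F) (Σₛ (λ H → φ (rk H) * μ F H)))
      ≡⟨ Σₛ-cong {n} (λ F → sym (Σₛ-when {n} (above F) _)) ⟩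
    Σₛ (λ F → Σₛ (λ H → when (above F) (φ (rk H) * μ F H)))
      ≡⟨ Σₛ-swap {n} {n} _ ⟩
    Σₛ (λ H → Σₛ (λ F → when (above F) (φ (rk H) * μ F H)))
      ≡⟨ Σₛ-cong {n} (λ H → trans (Σₛ-cong {n} (λ F → sym (when-*ˡ (above F) (φ (rk H)) (μ F H))))
                                 (Σₛ-*ˡ {n} (φ (rk H)) _)) ⟩
    Σₛ (λ H → φ (rk H) * Σₛ (λ F → when (above F) (μ F H)))
      ≡⟨ Σₛ-cong {n} (λ H → cong (φ (rk H) *_) (trans (Σₛ-cong {n} (narrow H)) (Σμ≡δ Z-flat H))) ⟩
    Σₛ (λ H → φ (rk H) * when (Z ≟ₛ H) 1ℤ)
      ≡⟨ Σₛ-cong {n} (λ H → trans (when-*ˡ (Z ≟ₛ H) (φ (rk H)) 1ℤ)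
                               (trans (when-≟-sym Z H _) (cong (when (H ≟ₛ Z)) (ℤₚ.*-identityʳ (φ (rk H)))))) ⟩
    Σₛ (λ H → when (H ≟ₛ Z) (φ (rk H)))
      ≡⟨ Σₛ-point Z (φ ∘ rk) ⟩
    φ (rk Z) ∎
    where
    open ≡-Reasoning
    above : (F : Subset n) → Dec (IsFlat E rk F × Z ⊆ F)
    above F = flat? F ×-dec Z ⊆? F
    narrow : ∀ H F → when (above F) (μ F H) ≡ when (flatBetween? Z F H) (μ F H)
    narrow H F = when-μ (above F) (flatBetween? Z F H) (proj₁ ∘ proj₁)
      (λ (F-flat , Z⊆F , _) → F-flat , Z⊆F) (λ (F-flat , Z⊆F) F⊆H → F-flat , Z⊆F , F⊆H)

module Contraction {n : ℕ} {E : Subset n} {rk : Subset n → ℕ} (M : IsMatroid E rk) (q : ℤ) where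
  open IsMatroid M
  open Closure M
  open Möbius M

  contractionPoly : Subset n → ℤ
  contractionPoly F = redCharPoly (E ─ F) (contractRk rk F) q

  contractionPoly≡Σₛ : {F : Subset n} → F ⊆ E →
    contractionPoly F ≡ Σₛ (λ A → when (A ⊆? E ─ F) (sign ∣ A ∣) * qint (rk E ∸ rk (A ∪ F)) q)
  contractionPoly≡Σₛ {F} F⊆E =
    trans (redCharPoly≡Σₛ (E ─ F) (contractRk rk F) q) (Σₛ-cong {n} contracted-rank)
    where
    contracted-rank : ∀ A → when (A ⊆? E ─ F) (sign ∣ A ∣ * qint (contractRk rk F (E ─ F) ∸ contractRk rk F A) q)
                            ≡ when (A ⊆? E ─ F) (sign ∣ A ∣) * qint (rk E ∸ rk (A ∪ F)) q
    contracted-rank A = trans (when-cong (A ⊆? E ─ F) λ A⊆E─F → cong (λ r → sign ∣ A ∣ * qint r q) (begin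
        (rk ((E ─ F) ∪ F) ∸ rk F) ∸ (rk (A ∪ F) ∸ rk F)
          ≡⟨ cong (λ X → (rk X ∸ rk F) ∸ (rk (A ∪ F) ∸ rk F)) (─-∪-cancel F⊆E) ⟩
        (rk E ∸ rk F) ∸ (rk (A ∪ F) ∸ rk F)
          ≡⟨ ℕₚ.∸-+-assoc (rk E) (rk F) _ ⟩
        rk E ∸ (rk F ℕ.+ (rk (A ∪ F) ∸ rk F))
          ≡⟨ cong (rk E ∸_) (ℕₚ.m+[n∸m]≡n (rk-mono F (A ∪ F) (q⊆p∪q A F) (─-⊆-∪ F⊆E A⊆E─F))) ⟩
        rk E ∸ rk (A ∪ F) ∎))
      (sym (when-*ʳ (A ⊆? E ─ F) (sign ∣ A ∣) _))
      where open ≡-Reasoning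

  properFlatOver? : (Z F : Subset n) → Dec (IsFlat E rk F × Z ⊆ F × F ⊂ E)
  properFlatOver? Z F = flat? F ×-dec (Z ⊆? F ×-dec F ⊂? E)

  Σ-contractionPoly : {Z : Subset n} → IsFlat E rk Z →
                      Σₛ (λ F → when (properFlatOver? Z F) (contractionPoly F)) ≡ qint (rk E ∸ rk Z) q
  Σ-contractionPoly {Z} Z-flat = begin
    Σₛ (λ F → when (properFlatOver? Z F) (contractionPoly F))
      ≡⟨ Σₛ-cong {n} drop-F≡E ⟩
    Σₛ (λ F → when (above F) (X F) - when (above F) (when (F ≟ₛ E) (X F)))
      ≡⟨ Σₛ-- {n} _ _ ⟩
    Σₛ (λ F → when (above F) (X F)) - Σₛ (λ F → when (above F) (when (F ≟ₛ E) (X F)))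
      ≡⟨ cong₂ _-_ (möbius-inversion φ Z-flat)
                   (trans (Σₛ-cong {n} (λ F → trans (cong (when (above F)) (F≡E-term F)) (when-zero (above F)))) (Σₛ-zero {n})) ⟩
    qint (rk E ∸ rk Z) q - 0ℤ
      ≡⟨ ℤₚ.+-identityʳ _ ⟩
    qint (rk E ∸ rk Z) q ∎
    where
    open ≡-Reasoning
    φ : ℕ → ℤ
    φ r = qint (rk E ∸ r) q
    X : Subset n → ℤ
    X F = Σₛ (λ A → when (A ⊆? E ─ F) (sign ∣ A ∣) * φ (rk (A ∪ F)))
    above : (F : Subset n) → Dec (IsFlat E rk F × Z ⊆ F)
    above F = flat? F ×-dec Z ⊆? F
    drop-F≡E : ∀ F → when (properFlatOver? Z F) (contractionPoly F)
                     ≡ when (above F) (X F) - when (above F) (when (F ≟ₛ E) (X F))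
    drop-F≡E F = begin
      when (flat? F ×-dec (Z ⊆? F ×-dec F ⊂? E)) (contractionPoly F)
        ≡⟨ trans (when-× (flat? F) (Z ⊆? F ×-dec F ⊂? E) _) (cong (when (flat? F)) (when-× (Z ⊆? F) (F ⊂? E) _)) ⟩
      when (flat? F) (when (Z ⊆? F) (when (F ⊂? E) (contractionPoly F)))
        ≡⟨ when-cong (flat? F) (λ F-flat → cong (when (Z ⊆? F)) (proper (proj₁ F-flat))) ⟩
      when (flat? F) (when (Z ⊆? F) (X F - when (F ≟ₛ E) (X F)))
        ≡⟨ trans (cong (when (flat? F)) (when-- (Z ⊆? F) _ _)) (when-- (flat? F) _ _) ⟩
      when (flat? F) (when (Z ⊆? F) (X F)) - when (flat? F) (when (Z ⊆? F) (when (F ≟ₛ E) (X F)))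
        ≡⟨ cong₂ _-_ (when-× (flat? F) (Z ⊆? F) _) (when-× (flat? F) (Z ⊆? F) _) ⟨
      when (above F) (X F) - when (above F) (when (F ≟ₛ E) (X F)) ∎
      where
      cancel : ∀ a b → a ≡ b + a - b
      cancel = solve-∀
      proper : F ⊆ E → when (F ⊂? E) (contractionPoly F) ≡ X F - when (F ≟ₛ E) (X F)
      proper F⊆E = begin
        when (F ⊂? E) (contractionPoly F)          ≡⟨ cong (when (F ⊂? E)) (contractionPoly≡Σₛ F⊆E) ⟩
        when (F ⊂? E) (X F)                        ≡⟨ cancel (when (F ⊂? E) (X F)) (when (F ≟ₛ E) (X F)) ⟩
        when (F ≟ₛ E) (X F) + when (F ⊂? E) (X F) - when (F ≟ₛ E) (X F)
                                                   ≡⟨ cong (_- when (F ≟ₛ E) (X F)) (when-⊆ F E (X F)) ⟨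
        when (F ⊆? E) (X F) - when (F ≟ₛ E) (X F)  ≡⟨ cong (_- when (F ≟ₛ E) (X F)) (when-yes (F ⊆? E) F⊆E (X F)) ⟩
        X F - when (F ≟ₛ E) (X F)                  ∎
    F≡E-term : ∀ F → when (F ≟ₛ E) (X F) ≡ 0ℤ
    F≡E-term F with F ≟ₛ E
    ... | no _     = refl
    ... | yes refl = trans (Σₛ-cong {n} vanish) (Σₛ-zero {n})
      where
      vanish : ∀ A → when (A ⊆? E ─ E) (sign ∣ A ∣) * φ (rk (A ∪ E)) ≡ 0ℤ
      vanish A with A ⊆? E ─ E
      ... | yes A⊆E─E = trans (cong (λ r → sign ∣ A ∣ * qint (rk E ∸ rk r) q) (∪-absorbˡ (⊆-trans A⊆E─E (p─q⊆p E E))))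
                              (trans (cong (λ r → sign ∣ A ∣ * qint r q) (ℕₚ.n∸n≡0 (rk E))) (ℤₚ.*-zeroʳ (sign ∣ A ∣)))
      ... | no _      = ℤₚ.*-zeroˡ (φ (rk (A ∪ E)))

  contractionPoly-⊥ : contractionPoly ⊥ ≡ redCharPoly E rk q
  contractionPoly-⊥ = begin
    contractionPoly ⊥
      ≡⟨ contractionPoly≡Σₛ ⊥⊆ ⟩
    Σₛ (λ A → when (A ⊆? E ─ ⊥) (sign ∣ A ∣) * qint (rk E ∸ rk (A ∪ ⊥)) q)
      ≡⟨ Σₛ-cong {n} (λ A → cong₂ (λ X Y → when (A ⊆? X) (sign ∣ A ∣) * qint (rk E ∸ rk Y) q)
                                  (p─⊥≡p E) (∪-identityʳ A)) ⟩
    Σₛ (λ A → when (A ⊆? E) (sign ∣ A ∣) * qint (rk E ∸ rk A) q)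
      ≡⟨ Σₛ-cong {n} (λ A → when-*ʳ (A ⊆? E) (sign ∣ A ∣) _) ⟩
    Σₛ (λ A → when (A ⊆? E) (sign ∣ A ∣ * qint (rk E ∸ rk A) q))
      ≡⟨ redCharPoly≡Σₛ E rk q ⟨
    redCharPoly E rk q ∎
    where open ≡-Reasoning

-- Flags and the recursion for H

module Flags {n : ℕ} (rk : Subset n → ℕ) (q : ℤ) where

  weight : Subset n → Subset n → ℤ
  weight Z A = qint (rk A ∸ rk Z) q - 1ℤ

  flatAbove? : (W Z A : Subset n) → Dec (IsFlat W rk A × Z ⊂ A)
  flatAbove? W Z A = isFlat? W rk A ×-dec Z ⊂? A

  flagSumOfLength : (W Z : Subset n) → ℕ → ℤ
  flagSumOfLength W Z zero    = 1ℤ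
  flagSumOfLength W Z (suc k) = Σₛ (λ A → when (flatAbove? W Z A) (weight Z A * flagSumOfLength W A k))

  flagSum : (W Z : Subset n) → ℤ
  flagSum W Z = Σ< (suc n) (flagSumOfLength W Z)

  Σ-flagsOfLength : (W Z : Subset n) (k : ℕ) →
    sumMap (λ L → when (flagAbove? W rk Z L) (flagWeight rk Z L q)) (listsOfLength k) ≡ flagSumOfLength W Z k
  Σ-flagsOfLength W Z zero    = ℤₚ.+-identityʳ 1ℤ
  Σ-flagsOfLength W Z (suc k) = begin
    sumMap h (concatMap (λ A → map (A ∷_) (listsOfLength k)) (allSubsets n))
      ≡⟨ sumMap-concatMap h (λ A → map (A ∷_) (listsOfLength k)) (allSubsets n) ⟩
    sumMap (λ A → sumMap h (map (A ∷_) (listsOfLength k))) (allSubsets n)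
      ≡⟨ sumMap-allSubsets n _ ⟩
    Σₛ (λ A → sumMap h (map (A ∷_) (listsOfLength k)))
      ≡⟨ Σₛ-cong {n} first-flat ⟩
    Σₛ (λ A → when (flatAbove? W Z A) (weight Z A * flagSumOfLength W A k)) ∎
    where
    open ≡-Reasoning
    h : List (Subset n) → ℤ
    h L = when (flagAbove? W rk Z L) (flagWeight rk Z L q)
    first-flat : ∀ A → sumMap h (map (A ∷_) (listsOfLength k))
                       ≡ when (flatAbove? W Z A) (weight Z A * flagSumOfLength W A k)
    first-flat A = begin
      sumMap h (map (A ∷_) (listsOfLength k))
        ≡⟨ sumMap-map h (A ∷_) (listsOfLength k) ⟩
      sumMap (λ L → when (isFlat? W rk A ×-dec (Z ⊂? A ×-dec flagAbove? W rk A L)) (weight Z A * flagWeight rk A L q)) (listsOfLength k)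
        ≡⟨ sumMap-cong (λ L → when-⇔ (isFlat? W rk A ×-dec (Z ⊂? A ×-dec flagAbove? W rk A L))
                                     (flatAbove? W Z A ×-dec flagAbove? W rk A L)
                                     (λ (a , b , c) → (a , b) , c) (λ ((a , b) , c) → a , b , c) _)
                       (listsOfLength k) ⟩
      sumMap (λ L → when (flatAbove? W Z A ×-dec flagAbove? W rk A L) (weight Z A * flagWeight rk A L q)) (listsOfLength k)
        ≡⟨ sumMap-cong (λ L → sym (when-*-when (flatAbove? W Z A) (flagAbove? W rk A L) (weight Z A) _)) (listsOfLength k) ⟩
      sumMap (λ L → when (flatAbove? W Z A) (weight Z A * when (flagAbove? W rk A L) (flagWeight rk A L q))) (listsOfLength k)
        ≡⟨ sumMap-when (flatAbove? W Z A) _ (listsOfLength k) ⟩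
      when (flatAbove? W Z A) (sumMap (λ L → weight Z A * when (flagAbove? W rk A L) (flagWeight rk A L q)) (listsOfLength k))
        ≡⟨ cong (when (flatAbove? W Z A)) (trans (sumMap-*ˡ (weight Z A) _ (listsOfLength k))
                                                  (cong (weight Z A *_) (Σ-flagsOfLength W A k))) ⟩
      when (flatAbove? W Z A) (weight Z A * flagSumOfLength W A k) ∎

  H≡flagSum : (W : Subset n) → H W rk q ≡ flagSum W (cl W rk ⊥)
  H≡flagSum W = begin
    sumMap (λ L → flagWeight rk Z L q) (filter (flagAbove? W rk Z) (listsUpTo n))
      ≡⟨ sumMap-filter (flagAbove? W rk Z) (λ L → flagWeight rk Z L q) (listsUpTo n) ⟩
    sumMap h (concatMap listsOfLength (upTo (suc n)))
      ≡⟨ sumMap-concatMap h listsOfLength (upTo (suc n)) ⟩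
    sumMap (λ k → sumMap h (listsOfLength k)) (upTo (suc n))
      ≡⟨ sumMap-applyUpTo (suc n) (λ k → sumMap h (listsOfLength k)) (λ k → k) ⟩
    Σ< (suc n) (λ k → sumMap h (listsOfLength k))
      ≡⟨ Σ<-cong (suc n) (Σ-flagsOfLength W Z) ⟩
    flagSum W Z ∎
    where
    open ≡-Reasoning
    Z : Subset n
    Z = cl W rk ⊥
    h : List (Subset n) → ℤ
    h L = when (flagAbove? W rk Z L) (flagWeight rk Z L q)

  flagSumOfLength-long : (W Z : Subset n) (k : ℕ) → n ℕ.< ∣ Z ∣ ℕ.+ k → flagSumOfLength W Z k ≡ 0ℤ
  flagSumOfLength-long W Z zero    n<∣Z∣+0 = contradiction (subst (ℕ._≤ n) (sym (ℕₚ.+-identityʳ _)) (∣p∣≤n Z)) (ℕₚ.<⇒≱ n<∣Z∣+0)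
  flagSumOfLength-long W Z (suc k) n<∣Z∣+1+k = trans (Σₛ-cong {n} term≡0) (Σₛ-zero {n})
    where
    term≡0 : ∀ A → when (flatAbove? W Z A) (weight Z A * flagSumOfLength W A k) ≡ 0ℤ
    term≡0 A = trans (when-cong (flatAbove? W Z A) (λ (_ , Z⊂A) →
                        trans (cong (weight Z A *_) (flagSumOfLength-long W A k (longer Z⊂A))) (ℤₚ.*-zeroʳ (weight Z A))))
                     (when-zero (flatAbove? W Z A))
      where
      longer : Z ⊂ A → n ℕ.< ∣ A ∣ ℕ.+ k
      longer Z⊂A = ℕₚ.<-≤-trans n<∣Z∣+1+k (subst (ℕ._≤ ∣ A ∣ ℕ.+ k) (sym (ℕₚ.+-suc ∣ Z ∣ k)) (ℕₚ.+-monoˡ-≤ k (p⊂q⇒∣p∣<∣q∣ Z⊂A)))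

  flagSum-rec : (W Z : Subset n) → flagSum W Z ≡ 1ℤ + Σₛ (λ A → when (flatAbove? W Z A) (weight Z A * flagSum W A))
  flagSum-rec W Z = cong (1ℤ +_) (begin
    Σ< n (λ k → Σₛ (λ A → when (flatAbove? W Z A) (weight Z A * flagSumOfLength W A k)))
      ≡⟨ Σ<-Σₛ n (λ k A → when (flatAbove? W Z A) (weight Z A * flagSumOfLength W A k)) ⟩
    Σₛ (λ A → Σ< n (λ k → when (flatAbove? W Z A) (weight Z A * flagSumOfLength W A k)))
      ≡⟨ Σₛ-cong {n} (λ A → trans (Σ<-when n (flatAbove? W Z A) _) (cong (when (flatAbove? W Z A)) (Σ<-*ˡ n (weight Z A) _))) ⟩
    Σₛ (λ A → when (flatAbove? W Z A) (weight Z A * Σ< n (flagSumOfLength W A)))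
      ≡⟨ Σₛ-cong {n} (λ A → when-cong (flatAbove? W Z A) (λ (_ , Z⊂A) → cong (weight Z A *_) (drop-last A Z⊂A))) ⟩
    Σₛ (λ A → when (flatAbove? W Z A) (weight Z A * flagSum W A)) ∎)
    where
    open ≡-Reasoning
    drop-last : ∀ A → Z ⊂ A → Σ< n (flagSumOfLength W A) ≡ flagSum W A
    drop-last A Z⊂A = sym (trans (Σ<-last n (flagSumOfLength W A))
      (trans (cong (Σ< n (flagSumOfLength W A) +_) (flagSumOfLength-long W A n n<∣A∣+n)) (ℤₚ.+-identityʳ _)))
      where
      n<∣A∣+n : n ℕ.< ∣ A ∣ ℕ.+ n
      n<∣A∣+n = ℕₚ.+-monoˡ-< n (ℕₚ.≤-trans (ℕ.s≤s ℕ.z≤n) (p⊂q⇒∣p∣<∣q∣ Z⊂A))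

  flagSum-self : (W : Subset n) → flagSum W W ≡ 1ℤ
  flagSum-self W = begin
    flagSum W W
      ≡⟨ flagSum-rec W W ⟩
    1ℤ + Σₛ (λ A → when (flatAbove? W W A) (weight W A * flagSum W A))
      ≡⟨ cong (1ℤ +_) (trans (Σₛ-cong {n} (λ A → when-no (flatAbove? W W A)
                                (λ (A-flat , W⊂A) → ⊂-irref refl (⊂-⊆-trans W⊂A (proj₁ A-flat))) _)) (Σₛ-zero {n})) ⟩
    1ℤ + 0ℤ
      ≡⟨ ℤₚ.+-identityʳ 1ℤ ⟩
    1ℤ ∎
    where open ≡-Reasoning

module Decomposition {n : ℕ} {E : Subset n} {rk : Subset n → ℕ} (M : IsMatroid E rk) (q : ℤ) where
  open Closure M
  open Möbius M
  open Contraction M q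
  open Flags rk q

  FlagSumDecomposes : Subset n → Set
  FlagSumDecomposes Z = flagSum E Z ≡ Σₛ (λ F → when (properFlatOver? Z F) (contractionPoly F * flagSum F Z))

  reindex : (Z F A : Subset n) →
    when (properFlatOver? Z F) (contractionPoly F * when (flatAbove? F Z A) (weight Z A * flagSum F A))
    ≡ when (flatAbove? E Z A) (weight Z A * when (properFlatOver? A F) (contractionPoly F * flagSum F A))
  reindex Z F A = begin
    when (properFlatOver? Z F) (contractionPoly F * when (flatAbove? F Z A) (weight Z A * flagSum F A))
      ≡⟨ when-*-when (properFlatOver? Z F) (flatAbove? F Z A) (contractionPoly F) (weight Z A * flagSum F A) ⟩
    when (properFlatOver? Z F ×-dec flatAbove? F Z A) (contractionPoly F * (weight Z A * flagSum F A))
      ≡⟨ when-⇔ (properFlatOver? Z F ×-dec flatAbove? F Z A) (flatAbove? E Z A ×-dec properFlatOver? A F) to from _ ⟩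
    when (flatAbove? E Z A ×-dec properFlatOver? A F) (contractionPoly F * (weight Z A * flagSum F A))
      ≡⟨ cong (when (flatAbove? E Z A ×-dec properFlatOver? A F)) (swap (contractionPoly F) (weight Z A) (flagSum F A)) ⟩
    when (flatAbove? E Z A ×-dec properFlatOver? A F) (weight Z A * (contractionPoly F * flagSum F A))
      ≡⟨ when-*-when (flatAbove? E Z A) (properFlatOver? A F) (weight Z A) (contractionPoly F * flagSum F A) ⟨
    when (flatAbove? E Z A) (weight Z A * when (properFlatOver? A F) (contractionPoly F * flagSum F A)) ∎
    where
    open ≡-Reasoning
    swap : ∀ x y z → x * (y * z) ≡ y * (x * z)
    swap = solve-∀
    to : (IsFlat E rk F × Z ⊆ F × F ⊂ E) × (IsFlat F rk A × Z ⊂ A) →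
         (IsFlat E rk A × Z ⊂ A) × (IsFlat E rk F × A ⊆ F × F ⊂ E)
    to ((F-flat , _ , F⊂E) , (A-flat-in-F , Z⊂A)) =
      (isFlat-restriction⁻ F-flat A-flat-in-F , Z⊂A) , (F-flat , proj₁ A-flat-in-F , F⊂E)
    from : (IsFlat E rk A × Z ⊂ A) × (IsFlat E rk F × A ⊆ F × F ⊂ E) →
           (IsFlat E rk F × Z ⊆ F × F ⊂ E) × (IsFlat F rk A × Z ⊂ A)
    from ((A-flat , Z⊂A) , (F-flat , A⊆F , F⊂E)) =
      (F-flat , ⊆-trans (proj₁ Z⊂A) A⊆F , F⊂E) , (isFlat-restriction⁺ F-flat A-flat A⊆F , Z⊂A)

  split-off-top : {Z : Subset n} → Z ⊂ E →
    Σₛ (λ A → when (flatAbove? E Z A) (weight Z A * flagSum E A))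
    ≡ weight Z E + Σₛ (λ A → when (flatAbove? E Z A) (weight Z A * when (A ⊂? E) (flagSum E A)))
  split-off-top {Z} Z⊂E = begin
    Σₛ (λ A → when (flatAbove? E Z A) (weight Z A * flagSum E A))
      ≡⟨ Σₛ-cong {n} (λ A → when-cong (flatAbove? E Z A) (λ (A-flat , _) → split A (proj₁ A-flat))) ⟩
    Σₛ (λ A → when (flatAbove? E Z A) (top A + lower A))
      ≡⟨ trans (Σₛ-cong {n} (λ A → when-+ (flatAbove? E Z A) (top A) (lower A))) (Σₛ-+ {n} _ _) ⟩
    Σₛ (λ A → when (flatAbove? E Z A) (top A)) + Σₛ (λ A → when (flatAbove? E Z A) (lower A))
      ≡⟨ cong (_+ Σₛ (λ A → when (flatAbove? E Z A) (lower A))) top-term ⟩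
    weight Z E + Σₛ (λ A → when (flatAbove? E Z A) (lower A)) ∎
    where
    open ≡-Reasoning
    top lower : Subset n → ℤ
    top A = weight Z A * when (A ≟ₛ E) (flagSum E A)
    lower A = weight Z A * when (A ⊂? E) (flagSum E A)
    split : ∀ A → A ⊆ E → weight Z A * flagSum E A ≡ top A + lower A
    split A A⊆E = trans (cong (weight Z A *_) (trans (sym (when-yes (A ⊆? E) A⊆E _)) (when-⊆ A E (flagSum E A))))
                        (ℤₚ.*-distribˡ-+ (weight Z A) _ _)
    top-term : Σₛ (λ A → when (flatAbove? E Z A) (top A)) ≡ weight Z E
    top-term = begin
      Σₛ (λ A → when (flatAbove? E Z A) (weight Z A * when (A ≟ₛ E) (flagSum E A)))
        ≡⟨ Σₛ-cong {n} (λ A → trans (cong (when (flatAbove? E Z A)) (when-*ˡ (A ≟ₛ E) (weight Z A) _))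
                                    (when-comm (flatAbove? E Z A) (A ≟ₛ E) _)) ⟩
      Σₛ (λ A → when (A ≟ₛ E) (when (flatAbove? E Z A) (weight Z A * flagSum E A)))
        ≡⟨ Σₛ-point E (λ A → when (flatAbove? E Z A) (weight Z A * flagSum E A)) ⟩
      when (flatAbove? E Z E) (weight Z E * flagSum E E)
        ≡⟨ when-yes (flatAbove? E Z E) (isFlat-ground E rk , Z⊂E) _ ⟩
      weight Z E * flagSum E E
        ≡⟨ trans (cong (weight Z E *_) (flagSum-self E)) (ℤₚ.*-identityʳ (weight Z E)) ⟩
      weight Z E ∎

  decompositions-above : {Z : Subset n} →
    (∀ {A} → IsFlat E rk A → Z ⊂ A → A ⊂ E → FlagSumDecomposes A) →
    Σₛ (λ F → when (properFlatOver? Z F) (contractionPoly F * Σₛ (λ A → when (flatAbove? F Z A) (weight Z A * flagSum F A))))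
    ≡ Σₛ (λ A → when (flatAbove? E Z A) (weight Z A * when (A ⊂? E) (flagSum E A)))
  decompositions-above {Z} ih = begin
    Σₛ (λ F → when (properFlatOver? Z F) (contractionPoly F * Σₛ (λ A → when (flatAbove? F Z A) (weight Z A * flagSum F A))))
      ≡⟨ Σₛ-cong {n} (λ F → trans (cong (when (properFlatOver? Z F)) (sym (Σₛ-*ˡ {n} (contractionPoly F) _)))
                                  (sym (Σₛ-when {n} (properFlatOver? Z F) _))) ⟩
    Σₛ (λ F → Σₛ (λ A → when (properFlatOver? Z F) (contractionPoly F * when (flatAbove? F Z A) (weight Z A * flagSum F A))))
      ≡⟨ Σₛ-swap {n} {n} _ ⟩
    Σₛ (λ A → Σₛ (λ F → when (properFlatOver? Z F) (contractionPoly F * when (flatAbove? F Z A) (weight Z A * flagSum F A))))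
      ≡⟨ Σₛ-cong {n} (λ A → Σₛ-cong {n} (λ F → reindex Z F A)) ⟩
    Σₛ (λ A → Σₛ (λ F → when (flatAbove? E Z A) (weight Z A * when (properFlatOver? A F) (contractionPoly F * flagSum F A))))
      ≡⟨ Σₛ-cong {n} (λ A → trans (Σₛ-when {n} (flatAbove? E Z A) _)
                                  (cong (when (flatAbove? E Z A)) (Σₛ-*ˡ {n} (weight Z A) _))) ⟩
    Σₛ (λ A → when (flatAbove? E Z A) (weight Z A * Σₛ (λ F → when (properFlatOver? A F) (contractionPoly F * flagSum F A))))
      ≡⟨ Σₛ-cong {n} (λ A → when-cong (flatAbove? E Z A) (λ (A-flat , Z⊂A) →
                       cong (weight Z A *_) (decomposed A A-flat Z⊂A))) ⟩
    Σₛ (λ A → when (flatAbove? E Z A) (weight Z A * when (A ⊂? E) (flagSum E A))) ∎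
    where
    open ≡-Reasoning
    decomposed : ∀ A → IsFlat E rk A → Z ⊂ A →
      Σₛ (λ F → when (properFlatOver? A F) (contractionPoly F * flagSum F A)) ≡ when (A ⊂? E) (flagSum E A)
    decomposed A A-flat Z⊂A with A ⊂? E
    ... | yes A⊂E = sym (ih A-flat Z⊂A A⊂E)
    ... | no  A⊄E = trans (Σₛ-cong {n} (λ F → when-no (properFlatOver? A F)
                                                (λ (_ , A⊆F , F⊂E) → A⊄E (⊆-⊂-trans A⊆F F⊂E)) _))
                          (Σₛ-zero {n})

  decomposes-step : {Z : Subset n} → IsFlat E rk Z → Z ⊂ E →
    (∀ {A} → IsFlat E rk A → Z ⊂ A → A ⊂ E → FlagSumDecomposes A) → FlagSumDecomposes Z
  decomposes-step {Z} Z-flat Z⊂E ih = sym (begin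
    Σₛ (λ F → when (properFlatOver? Z F) (contractionPoly F * flagSum F Z))
      ≡⟨ Σₛ-cong {n} (λ F → cong (when (properFlatOver? Z F)) (trans (cong (contractionPoly F *_) (flagSum-rec F Z))
                                                                     (ℤₚ.*-distribˡ-+ (contractionPoly F) 1ℤ _))) ⟩
    Σₛ (λ F → when (properFlatOver? Z F) (contractionPoly F * 1ℤ + contractionPoly F * higher F))
      ≡⟨ trans (Σₛ-cong {n} (λ F → when-+ (properFlatOver? Z F) _ _)) (Σₛ-+ {n} _ _) ⟩
    Σₛ (λ F → when (properFlatOver? Z F) (contractionPoly F * 1ℤ))
      + Σₛ (λ F → when (properFlatOver? Z F) (contractionPoly F * higher F))
      ≡⟨ cong₂ _+_ (trans (Σₛ-cong {n} (λ F → cong (when (properFlatOver? Z F)) (ℤₚ.*-identityʳ _))) (Σ-contractionPoly Z-flat))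
                   (decompositions-above ih) ⟩
    qint (rk E ∸ rk Z) q + Rest
      ≡⟨ rearrange (qint (rk E ∸ rk Z) q) Rest ⟩
    1ℤ + (weight Z E + Rest)
      ≡⟨ cong (1ℤ +_) (split-off-top Z⊂E) ⟨
    1ℤ + Σₛ (λ A → when (flatAbove? E Z A) (weight Z A * flagSum E A))
      ≡⟨ flagSum-rec E Z ⟨
    flagSum E Z ∎)
    where
    open ≡-Reasoning
    rearrange : ∀ a r → a + r ≡ 1ℤ + ((a - 1ℤ) + r)
    rearrange = solve-∀
    higher : Subset n → ℤ
    higher F = Σₛ (λ A → when (flatAbove? F Z A) (weight Z A * flagSum F A))
    Rest : ℤ
    Rest = Σₛ (λ A → when (flatAbove? E Z A) (weight Z A * when (A ⊂? E) (flagSum E A)))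

  flagSum-decomposes : {Z : Subset n} → IsFlat E rk Z → Z ⊂ E → FlagSumDecomposes Z
  flagSum-decomposes {Z} = All.wfRec ⊃-wellFounded 0ℓ P step Z
    where
    P : Subset n → Set
    P Z = IsFlat E rk Z → Z ⊂ E → FlagSumDecomposes Z
    step : ∀ Z → (∀ {A} → Z ⊂ A → P A) → P Z
    step Z rec Z-flat Z⊂E = decomposes-step Z-flat Z⊂E (λ A-flat Z⊂A A⊂E → rec Z⊂A A-flat A⊂E)

module LooplessMatroid {n : ℕ} {E : Subset n} {rk : Subset n → ℕ} (M : IsMatroid E rk) (loopless : Loopless E rk) (q : ℤ) where
  open Closure M
  open Möbius M
  open Contraction M q
  open Flags rk q

  cl⊥≡⊥ : cl E rk ⊥ ≡ ⊥
  cl⊥≡⊥ = cl-⊥-loopless loopless ⊆-refl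

  innerFlat? : (F : Subset n) → Dec (IsFlat E rk F × ⊥ ⊂ F × F ⊂ E)
  innerFlat? F = flat? F ×-dec (⊥ ⊂? F ×-dec F ⊂? E)

  sumMap-Lhat : (g : Subset n → ℤ) → sumMap g (Lhat E rk) ≡ Σₛ (λ F → when (innerFlat? F) (g F))
  sumMap-Lhat g = begin
    sumMap g (Lhat E rk)
      ≡⟨ sumMap-filter (λ F → cl E rk ⊥ ⊂? F) g (filter (λ F → F ⊂? E) (flats E rk)) ⟩
    sumMap (λ F → when (cl E rk ⊥ ⊂? F) (g F)) (filter (λ F → F ⊂? E) (flats E rk))
      ≡⟨ sumMap-filter (λ F → F ⊂? E) _ (flats E rk) ⟩
    sumMap (λ F → when (F ⊂? E) (when (cl E rk ⊥ ⊂? F) (g F))) (flats E rk)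
      ≡⟨ sumMap-filter flat? _ (allSubsets n) ⟩
    sumMap (λ F → when (flat? F) (when (F ⊂? E) (when (cl E rk ⊥ ⊂? F) (g F)))) (allSubsets n)
      ≡⟨ sumMap-allSubsets n _ ⟩
    Σₛ (λ F → when (flat? F) (when (F ⊂? E) (when (cl E rk ⊥ ⊂? F) (g F))))
      ≡⟨ Σₛ-cong {n} (λ F → trans (when-× (flat? F) (F ⊂? E ×-dec cl E rk ⊥ ⊂? F) (g F))
                                  (cong (when (flat? F)) (when-× (F ⊂? E) (cl E rk ⊥ ⊂? F) (g F)))) ⟨
    Σₛ (λ F → when (flat? F ×-dec (F ⊂? E ×-dec cl E rk ⊥ ⊂? F)) (g F))
      ≡⟨ Σₛ-cong {n} (λ F → when-⇔ (flat? F ×-dec (F ⊂? E ×-dec cl E rk ⊥ ⊂? F)) (innerFlat? F)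
           (λ (F-flat , F⊂E , cl⊥⊂F) → F-flat , subst (_⊂ F) cl⊥≡⊥ cl⊥⊂F , F⊂E)
           (λ (F-flat , ⊥⊂F , F⊂E) → F-flat , F⊂E , subst (_⊂ F) (sym cl⊥≡⊥) ⊥⊂F) (g F)) ⟩
    Σₛ (λ F → when (innerFlat? F) (g F)) ∎
    where open ≡-Reasoning

  split-bottom : ⊥ ⊂ E →
    Σₛ (λ F → when (properFlatOver? ⊥ F) (contractionPoly F * flagSum F ⊥))
    ≡ redCharPoly E rk q + Σₛ (λ F → when (innerFlat? F) (contractionPoly F * H F rk q))
  split-bottom ⊥⊂E = begin
    Σₛ (λ F → when (properFlatOver? ⊥ F) (contractionPoly F * flagSum F ⊥))
      ≡⟨ Σₛ-split ⊥ (λ F → when (properFlatOver? ⊥ F) (contractionPoly F * flagSum F ⊥)) ⟩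
    when (properFlatOver? ⊥ ⊥) (contractionPoly ⊥ * flagSum ⊥ ⊥)
      + Σₛ (λ F → when (¬? (F ≟ₛ ⊥)) (when (properFlatOver? ⊥ F) (contractionPoly F * flagSum F ⊥)))
      ≡⟨ cong₂ _+_ bottom (Σₛ-cong {n} inner) ⟩
    redCharPoly E rk q + Σₛ (λ F → when (innerFlat? F) (contractionPoly F * H F rk q)) ∎
    where
    open ≡-Reasoning
    bottom : when (properFlatOver? ⊥ ⊥) (contractionPoly ⊥ * flagSum ⊥ ⊥) ≡ redCharPoly E rk q
    bottom = trans (when-yes (properFlatOver? ⊥ ⊥) ((⊥⊆ , cl⊥≡⊥) , ⊆-refl , ⊥⊂E) _)
                   (trans (cong₂ _*_ contractionPoly-⊥ (flagSum-self ⊥)) (ℤₚ.*-identityʳ _))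
    inner : ∀ F → when (¬? (F ≟ₛ ⊥)) (when (properFlatOver? ⊥ F) (contractionPoly F * flagSum F ⊥))
                  ≡ when (innerFlat? F) (contractionPoly F * H F rk q)
    inner F with F ≟ₛ ⊥
    ... | yes refl = sym (when-no (innerFlat? ⊥) (λ (_ , ⊥⊂⊥ , _) → ⊂-irref refl ⊥⊂⊥) _)
    ... | no  F≢⊥  = begin
      when (properFlatOver? ⊥ F) (contractionPoly F * flagSum F ⊥)
        ≡⟨ when-⇔ (properFlatOver? ⊥ F) (innerFlat? F)
             (λ (F-flat , _ , F⊂E) → F-flat , ⊆∧≢⇒⊂ ⊥⊆ (F≢⊥ ∘ sym) , F⊂E)
             (λ (F-flat , _ , F⊂E) → F-flat , ⊥⊆ , F⊂E) _ ⟩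
      when (innerFlat? F) (contractionPoly F * flagSum F ⊥)
        ≡⟨ when-cong (innerFlat? F) (λ (F-flat , _) → cong (contractionPoly F *_)
             (trans (cong (flagSum F) (sym (cl-⊥-loopless loopless (proj₁ F-flat)))) (sym (H≡flagSum F)))) ⟩
      when (innerFlat? F) (contractionPoly F * H F rk q) ∎

lemma4p2 : (n : ℕ) (E : Subset n) (rk : Subset n → ℕ) →
    IsMatroid E rk → Loopless E rk → Nonempty E →
    (q : ℤ) →
    H E rk q ≡ redCharPoly E rk q
      + sumℤ (map (λ F → redCharPoly (E ─ F) (contractRk rk F) q * H F rk q) (Lhat E rk))
lemma4p2 n E rk M loopless (x , x∈E) q = begin
  H E rk q
    ≡⟨ H≡flagSum E ⟩
  flagSum E (cl E rk ⊥)
    ≡⟨ cong (flagSum E) cl⊥≡⊥ ⟩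
  flagSum E ⊥
    ≡⟨ flagSum-decomposes (⊥⊆ , cl⊥≡⊥) ⊥⊂E ⟩
  Σₛ (λ F → when (properFlatOver? ⊥ F) (contractionPoly F * flagSum F ⊥))
    ≡⟨ split-bottom ⊥⊂E ⟩
  redCharPoly E rk q + Σₛ (λ F → when (innerFlat? F) (contractionPoly F * H F rk q))
    ≡⟨ cong (redCharPoly E rk q +_) (sumMap-Lhat (λ F → contractionPoly F * H F rk q)) ⟨
  redCharPoly E rk q + sumℤ (map (λ F → redCharPoly (E ─ F) (contractRk rk F) q * H F rk q) (Lhat E rk)) ∎
  where
  open ≡-Reasoning
  open Flags rk q
  open Contraction M q
  open Decomposition M q
  open LooplessMatroid M loopless q
  ⊥⊂E : ⊥ ⊂ E
  ⊥⊂E = ⊥⊆ , x , x∈E , ∉⊥
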